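{- $K_{10}$ and $K_{12}-C_{12}$ are both graphs with vertex connectivity $9$ and orientable genus $4$. $K_{14}$ and $K_{15}-6K_2$ are both graphs with vertex connectivity $13$ and orientable genus $10$. In particular, $K_{10}$ (respectively $K_{14}$) is not the unique complete graph's-parameter-realizer: there is a non-complete graph with the same vertex connectivity and genus as $K_{10}$ (respectively $K_{14}$).
   Context: $K_n$ is the complete graph on $n$ vertices. $K_{12}-C_{12}$ is $K_{12}$ with the edges of a Hamiltonian cycle removed. $K_{15}-6K_2$ is $K_{15}$ with the edges of a matching of size $6$ removed. The orientable genus of a graph is the minimum genus of an orientable surface in which it embeds; vertex connectivity is the minimum number of vertices whose removal disconnects the graph (or leaves a single vertex). -}

module Defs where

open import Data.Bool using (Bool; true; false; not; _∧_; T)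
open import Data.Nat using (ℕ; zero; suc; _+_; _*_; _≤_; _<_; _≡ᵇ_; _<ᵇ_; _≤ᵇ_; _%_; _/_)
open import Data.Fin using (Fin; toℕ)
open import Data.Fin.Subset using (Subset; ∣_∣)
open import Data.Vec using (lookup)
open import Data.List using (List; []; _∷_; length; filterᵇ; cartesianProduct; allFin; upTo)
open import Data.Product using (_×_; _,_; ∃-syntax; Σ-syntax)
open import Data.Sum using (_⊎_)
open import Relation.Binary.PropositionalEquality using (_≡_; _≢_)
open import Relation.Nullary using (¬_)

-- Finite simple graphs on the vertex set Fin n, given by a Boolean
-- adjacency function.  (All concrete graphs below are symmetric and
-- loopless by construction.)

Graph : ℕ → Set
Graph n = Fin n → Fin n → Bool

Adj : ∀ {n} → Graph n → Fin n → Fin n → Set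
Adj G u v = G u v ≡ true

_≟ᶠ_ : ∀ {n} → Fin n → Fin n → Bool
u ≟ᶠ v = toℕ u ≡ᵇ toℕ v

K : (n : ℕ) → Graph n
K n u v = not (u ≟ᶠ v)

cycSucc : ℕ → ℕ → ℕ
cycSucc zero    i = i
cycSucc (suc m) i = suc i % suc m

KminusCycle : (n : ℕ) → Graph n
KminusCycle n u v =
  not (u ≟ᶠ v)
  ∧ not (cycSucc n (toℕ u) ≡ᵇ toℕ v)
  ∧ not (cycSucc n (toℕ v) ≡ᵇ toℕ u)

-- K_n minus the perfect-on-its-support matching {2i, 2i+1}, i < m
-- (i.e. K_n - m K_2, for 2m ≤ n)
KminusMatching : (n m : ℕ) → Graph n
KminusMatching n m u v =
  not (u ≟ᶠ v)
  ∧ not ((toℕ u / 2 ≡ᵇ toℕ v / 2) ∧ (toℕ u <ᵇ 2 * m) ∧ (toℕ v <ᵇ 2 * m))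

IsComplete : ∀ {n} → Graph n → Set
IsComplete {n} G = ∀ (u v : Fin n) → u ≢ v → Adj G u v

data Reach {n} (G : Graph n) (S : Subset n) : Fin n → Fin n → Set where
  here : ∀ {u} → lookup S u ≡ false → Reach G S u u
  step : ∀ {u w v} → lookup S u ≡ false → Adj G u w →
         Reach G S w v → Reach G S u v

Separating : ∀ {n} → Graph n → Subset n → Set
Separating {n} G S =
  (∃[ u ] ∃[ v ] (lookup S u ≡ false × lookup S v ≡ false × ¬ Reach G S u v))
  ⊎ (n ≤ ∣ S ∣ + 1)

VertexConnectivity : ∀ {n} → Graph n → ℕ → Set
VertexConnectivity {n} G k =
  (∃[ S ] (∣ S ∣ ≡ k × Separating G S))
  × (∀ (S : Subset n) → Separating G S → k ≤ ∣ S ∣)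

-- Orientable genus via rotation systems
-- (Heffter–Edmonds–Ringel rotation principle: cellular embeddings of a
-- connected graph in orientable surfaces correspond to rotation systems;
-- the embedding surface has Euler characteristic V - E + F.)

iter : ∀ {A : Set} → (A → A) → ℕ → A → A
iter f zero    x = x
iter f (suc k) x = f (iter f k x)

record Rotation {n} (G : Graph n) : Set where
  field
    ρ      : Fin n → Fin n → Fin n
    closed : ∀ v u → Adj G v u → Adj G v (ρ v u)
    cyclic : ∀ v u w → Adj G v u → Adj G v w → ∃[ k ] iter (ρ v) k u ≡ w

allᵇ : ∀ {A : Set} → (A → Bool) → List A → Bool
allᵇ p []       = true
allᵇ p (x ∷ xs) = p x ∧ allᵇ p xs

pairs : (n : ℕ) → List (Fin n × Fin n)
pairs n = cartesianProduct (allFin n) (allFin n)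

numEdges : ∀ {n} → Graph n → ℕ
numEdges {n} G = length (filterᵇ (λ { (u , v) → G u v ∧ (toℕ u <ᵇ toℕ v) }) (pairs n))

module _ {n : ℕ} {G : Graph n} (R : Rotation G) where
  open Rotation R

  -- face-tracing permutation on darts: (u,v) ↦ (v, ρ_v(u))
  faceStep : Fin n × Fin n → Fin n × Fin n
  faceStep (u , v) = (v , ρ v u)

  code : Fin n × Fin n → ℕ
  code (u , v) = toℕ u * n + toℕ v

  -- a dart is the representative of its face if its code is minimal
  -- in its faceStep-orbit (orbits have length ≤ n * n)
  isRep : Fin n × Fin n → Bool
  isRep (u , v) = G u v ∧ allᵇ (λ k → code (u , v) ≤ᵇ code (iter faceStep k (u , v))) (upTo (n * n))

  numFaces : ℕ
  numFaces = length (filterᵇ isRep (pairs n))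

-- genus of the embedding given by R is g  iff  V - E + F = 2 - 2g
-- orientable genus of (connected) G is g iff g is the least such genus
OrientableGenus : ∀ {n} → Graph n → ℕ → Set
OrientableGenus {n} G g =
  (Σ[ R ∈ Rotation G ] (n + numFaces R + 2 * g ≡ 2 + numEdges G))
  × (∀ (R : Rotation G) → n + numFaces R + 2 * g ≤ 2 + numEdges G)

{-# OPTIONS --safe #-}
-- Connectivity: a separating set of the required size is exhibited (all but one vertex, or the neighbourhood
-- of a vertex), and every pair of vertices is joined by k internally disjoint paths: k common neighbours,
-- or k - 1 of them together with a path of length three.
--
-- Genus: the upper bound is an explicit rotation system. For the lower bound, the faces of any rotation
-- system are the cycles of the permutation rotate ∘ reverse of the darts. No face has length 1 or 2, so
-- 3F ≤ 2E; and reverse is a product of E transpositions while rotate has one cycle per vertex, so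
-- F ≡ E + V (mod 2). Together they bound F, hence the genus. Parity is what rules out triangulations of
-- K₁₀ and K₁₄, for which V - E + F would be odd.
module Submission where

open import Defs
import Data.Bool as Bool
open import Data.Bool using (Bool; true; false; not; _∧_; _∨_; if_then_else_; T)
open import Data.Bool.Properties using (∧-conicalˡ; ∧-conicalʳ; ∧-zeroʳ; not-involutive; not-injective; T-≡)
open import Data.Nat using (ℕ; zero; suc; _+_; _*_; _∸_; _≤_; _<_; z≤n; s≤s; _≤ᵇ_; _<ᵇ_; _%_; _/_; z<s)
open import Data.Nat.Properties hiding (_≟_)
open import Algebra.Properties.CommutativeSemigroup +-commutativeSemigroup using () renaming (interchange to +-interchange)
open import Data.Nat.DivMod using (m≡m%n+[m/n]*n; m%n<n)
open import Data.Fin using (Fin; toℕ; combine; fromℕ<; #_) renaming (zero to fzero; suc to fsuc)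
open import Data.Fin.Properties using (toℕ-injective; toℕ-combine; combine-injective; toℕ<n; toℕ-fromℕ<; pigeonhole; any?; all?) renaming (_≟_ to _≟ᶠ′_)
open import Data.List using (List; []; _∷_; length; map; filterᵇ; cartesianProduct; allFin; upTo; applyUpTo; _++_)
open import Data.List.Properties using (map-tabulate; length-map; length-tabulate)
open import Data.List.Membership.Propositional using (_∈_)
open import Data.List.Membership.Propositional.Properties using (∈-upTo⁺; ∈-applyUpTo⁺; ∈-applyUpTo⁻)
open import Data.List.Relation.Unary.Any using (here; there)
open import Data.List.Relation.Unary.All using (All; []; _∷_)
open import Data.Vec using (Vec; []; _∷_; lookup; tabulate)
open import Data.Vec.Properties using (lookup∘tabulate; lookup⇒[]=; []=⇒lookup)
open import Data.Fin.Subset using (Subset; ∣_∣; _∪_; ⁅_⁆; ∁)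
open import Data.Fin.Subset.Properties using (x∈p∪q⁻; x∈⁅y⁆⇒x≡y)
import Data.List.Relation.Unary.All as All
open import Data.List.Extrema.Nat using (argmin; argmin-sel; f[argmin]≤f[xs])
open import Data.Product using (_×_; _,_; proj₁; proj₂; ∃; ∃-syntax)
open import Data.Product.Properties using (,-injective; ×-≡,≡→≡)
open import Data.Sum using (_⊎_; inj₁; inj₂)
open import Data.Empty using (⊥; ⊥-elim)
open import Function using (_∘_; id; Injective; Equivalence)
open import Relation.Binary.PropositionalEquality
open import Relation.Binary.Definitions using (DecidableEquality)
open import Relation.Nullary using (¬_; Dec; yes; no; does; contradiction)
open import Relation.Nullary.Decidable using (map′; _×-dec_; _⊎-dec_; _→-dec_; ¬?; True; does-≡; dec-true; dec-false; toWitness)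

𝟙 : Bool → ℕ
𝟙 true  = 1
𝟙 false = 0

∑ : {A : Set} → List A → (A → ℕ) → ℕ
∑ []       f = 0
∑ (x ∷ xs) f = f x + ∑ xs f

syntax ∑ xs (λ x → e) = ∑[ x ∈ xs ] e

module _ {A : Set} where

  ∑-cong : ∀ xs {f g : A → ℕ} → (∀ x → f x ≡ g x) → ∑ xs f ≡ ∑ xs g
  ∑-cong []       f≗g = refl
  ∑-cong (x ∷ xs) f≗g = cong₂ _+_ (f≗g x) (∑-cong xs f≗g)

  ∑-mono-≤ : ∀ xs {f g : A → ℕ} → (∀ x → f x ≤ g x) → ∑ xs f ≤ ∑ xs g
  ∑-mono-≤ []       f≤g = z≤n
  ∑-mono-≤ (x ∷ xs) f≤g = +-mono-≤ (f≤g x) (∑-mono-≤ xs f≤g)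

  ∑-distrib-+ : ∀ xs (f g : A → ℕ) → ∑[ x ∈ xs ] (f x + g x) ≡ ∑ xs f + ∑ xs g
  ∑-distrib-+ []       f g = refl
  ∑-distrib-+ (x ∷ xs) f g =
    trans (cong (f x + g x +_) (∑-distrib-+ xs f g)) (+-interchange (f x) (g x) (∑ xs f) (∑ xs g))

  ∑-distribʳ-* : ∀ xs (f : A → ℕ) c → ∑[ x ∈ xs ] (f x * c) ≡ ∑ xs f * c
  ∑-distribʳ-* []       f c = refl
  ∑-distribʳ-* (x ∷ xs) f c = trans (cong (f x * c +_) (∑-distribʳ-* xs f c)) (sym (*-distribʳ-+ c (f x) (∑ xs f)))

  ∑-1 : ∀ (xs : List A) → ∑[ x ∈ xs ] 1 ≡ length xs
  ∑-1 []       = refl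
  ∑-1 (x ∷ xs) = cong suc (∑-1 xs)

  ∑-zero : ∀ (xs : List A) → ∑[ x ∈ xs ] 0 ≡ 0
  ∑-zero []       = refl
  ∑-zero (x ∷ xs) = ∑-zero xs

  ∑-++ : ∀ xs ys (f : A → ℕ) → ∑ (xs ++ ys) f ≡ ∑ xs f + ∑ ys f
  ∑-++ []       ys f = refl
  ∑-++ (x ∷ xs) ys f = trans (cong (f x +_) (∑-++ xs ys f)) (sym (+-assoc (f x) _ _))

  ∑-map : ∀ {B : Set} (g : B → A) xs (f : A → ℕ) → ∑ (map g xs) f ≡ ∑[ x ∈ xs ] f (g x)
  ∑-map g []       f = refl
  ∑-map g (x ∷ xs) f = cong (f (g x) +_) (∑-map g xs f)

  length-filterᵇ : ∀ (p : A → Bool) xs → length (filterᵇ p xs) ≡ ∑[ x ∈ xs ] 𝟙 (p x)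
  length-filterᵇ p []       = refl
  length-filterᵇ p (x ∷ xs) with p x
  ... | true  = cong suc (length-filterᵇ p xs)
  ... | false = length-filterᵇ p xs

∑-comm : {A B : Set} (xs : List A) (ys : List B) (h : A → B → ℕ) →
         ∑[ x ∈ xs ] ∑[ y ∈ ys ] h x y ≡ ∑[ y ∈ ys ] ∑[ x ∈ xs ] h x y
∑-comm []       ys h = sym (∑-zero ys)
∑-comm (x ∷ xs) ys h = trans (cong (∑ ys (h x) +_) (∑-comm xs ys h))
                             (sym (∑-distrib-+ ys (h x) (λ y → ∑[ x ∈ xs ] h x y)))

∑-cartesianProduct : {A B : Set} (xs : List A) (ys : List B) (h : A × B → ℕ) →
                     ∑ (cartesianProduct xs ys) h ≡ ∑[ x ∈ xs ] ∑[ y ∈ ys ] h (x , y)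
∑-cartesianProduct []       ys h = refl
∑-cartesianProduct (x ∷ xs) ys h = begin
  ∑ (map (x ,_) ys ++ cartesianProduct xs ys) h           ≡⟨ ∑-++ (map (x ,_) ys) _ h ⟩
  ∑ (map (x ,_) ys) h + ∑ (cartesianProduct xs ys) h      ≡⟨ cong₂ _+_ (∑-map (x ,_) ys h) (∑-cartesianProduct xs ys h) ⟩
  ∑[ y ∈ ys ] h (x , y) + ∑[ x ∈ xs ] ∑[ y ∈ ys ] h (x , y) ∎
  where open ≡-Reasoning

𝟙-disjoint-≤ : ∀ {a b c d} → (a ≡ true → d ≡ true) → (b ≡ true → d ≡ true) → (c ≡ true → d ≡ true) →
               (a ≡ true → b ≡ true → ⊥) → (a ≡ true → c ≡ true → ⊥) → (b ≡ true → c ≡ true → ⊥) →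
               𝟙 a + 𝟙 b + 𝟙 c ≤ 𝟙 d
𝟙-disjoint-≤ {true}  {true}  a⇒d b⇒d c⇒d a#b a#c b#c = ⊥-elim (a#b refl refl)
𝟙-disjoint-≤ {true}  {false} {true}  a⇒d b⇒d c⇒d a#b a#c b#c = ⊥-elim (a#c refl refl)
𝟙-disjoint-≤ {false} {true}  {true}  a⇒d b⇒d c⇒d a#b a#c b#c = ⊥-elim (b#c refl refl)
𝟙-disjoint-≤ {true}  {false} {false} a⇒d b⇒d c⇒d a#b a#c b#c rewrite a⇒d refl = ≤-refl
𝟙-disjoint-≤ {false} {true}  {false} a⇒d b⇒d c⇒d a#b a#c b#c rewrite b⇒d refl = ≤-refl
𝟙-disjoint-≤ {false} {false} {true}  a⇒d b⇒d c⇒d a#b a#c b#c rewrite c⇒d refl = ≤-refl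
𝟙-disjoint-≤ {false} {false} {false} a⇒d b⇒d c⇒d a#b a#c b#c = z≤n

𝟙-∧-∨ : ∀ r p q → (p ≡ true → q ≡ true → ⊥) → 𝟙 (r ∧ (p ∨ q)) ≡ 𝟙 (r ∧ p) + 𝟙 (r ∧ q)
𝟙-∧-∨ false p     q     p#q = refl
𝟙-∧-∨ true  true  true  p#q = ⊥-elim (p#q refl refl)
𝟙-∧-∨ true  true  false p#q = refl
𝟙-∧-∨ true  false q     p#q = refl

module _ {A : Set} (p : A → Bool) where

  allᵇ-sound : ∀ {xs x} → allᵇ p xs ≡ true → x ∈ xs → p x ≡ true
  allᵇ-sound {y ∷ xs} all-p (here refl) with p y | all-p
  ... | true | _ = refl
  allᵇ-sound {y ∷ xs} all-p (there x∈xs) with p y | all-p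
  ... | true | all-p′ = allᵇ-sound all-p′ x∈xs

  allᵇ-complete : ∀ xs → (∀ {x} → x ∈ xs → p x ≡ true) → allᵇ p xs ≡ true
  allᵇ-complete []       _     = refl
  allᵇ-complete (x ∷ xs) all-p rewrite all-p (here refl) = allᵇ-complete xs (λ x∈xs → all-p (there x∈xs))

allᵇ-cong : ∀ {A : Set} {p q : A → Bool} → (∀ x → p x ≡ q x) → ∀ xs → allᵇ p xs ≡ allᵇ q xs
allᵇ-cong p≗q []       = refl
allᵇ-cong p≗q (x ∷ xs) = cong₂ _∧_ (p≗q x) (allᵇ-cong p≗q xs)

≤ᵇ-sound : ∀ {m n} → (m ≤ᵇ n) ≡ true → m ≤ n
≤ᵇ-sound {m} {n} m≤ᵇn = ≤ᵇ⇒≤ m n (Equivalence.from T-≡ m≤ᵇn)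

does-sound : ∀ {P : Set} (P? : Dec P) → does P? ≡ true → P
does-sound (yes p) _ = p

≤ᵇ-complete : ∀ {m n} → m ≤ n → (m ≤ᵇ n) ≡ true
≤ᵇ-complete m≤n = Equivalence.to T-≡ (≤⇒≤ᵇ m≤n)

even : ℕ → Bool
even zero    = true
even (suc n) = not (even n)

even-+-cancelʳ : ∀ {m n} k → even (m + k) ≡ even (n + k) → even m ≡ even n
even-+-cancelʳ {m} {n} zero    eq = trans (cong even (sym (+-identityʳ m))) (trans eq (cong even (+-identityʳ n)))
even-+-cancelʳ {m} {n} (suc k) eq = even-+-cancelʳ {m} {n} k (not-injective (trans (cong even (sym (+-suc m k))) (trans eq (cong even (+-suc n k)))))

-- Finite types
record Listing (A : Set) : Set where
  field
    _≟_      : DecidableEquality A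
    elements : List A
    once     : ∀ y → ∑[ x ∈ elements ] 𝟙 (does (x ≟ y)) ≡ 1

module _ {A : Set} (L : Listing A) where
  open Listing L

  ∑-point : ∀ y (g : A → ℕ) → ∑[ x ∈ elements ] (𝟙 (does (x ≟ y)) * g x) ≡ g y
  ∑-point y g = begin
    ∑[ x ∈ elements ] (𝟙 (does (x ≟ y)) * g x) ≡⟨ ∑-cong elements at-y ⟩
    ∑[ x ∈ elements ] (𝟙 (does (x ≟ y)) * g y) ≡⟨ ∑-distribʳ-* elements _ (g y) ⟩
    ∑[ x ∈ elements ] 𝟙 (does (x ≟ y)) * g y   ≡⟨ cong (_* g y) (once y) ⟩
    1 * g y                                    ≡⟨ *-identityˡ (g y) ⟩
    g y                                        ∎
    where
    open ≡-Reasoning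
    at-y : ∀ x → 𝟙 (does (x ≟ y)) * g x ≡ 𝟙 (does (x ≟ y)) * g y
    at-y x with x ≟ y
    ... | yes refl = refl
    ... | no _     = refl

  ∑-𝟙-unique : ∀ (p : A → Bool) y → (∀ x → p x ≡ true → x ≡ y) → p y ≡ true →
               ∑[ x ∈ elements ] 𝟙 (p x) ≡ 1
  ∑-𝟙-unique p y p⇒≡y py = trans (∑-cong elements p≗[≡y]) (once y)
    where
    p≗[≡y] : ∀ x → 𝟙 (p x) ≡ 𝟙 (does (x ≟ y))
    p≗[≡y] x with x ≟ y | p x in px
    ... | yes refl | _     = cong 𝟙 (trans (sym px) py)
    ... | no _     | false = refl
    ... | no x≢y   | true  = contradiction (p⇒≡y x px) x≢y

  ∑-bijection : (h h⁻¹ : A → A) → (∀ x → h⁻¹ (h x) ≡ x) → (∀ y → h (h⁻¹ y) ≡ y) →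
                (g : A → ℕ) → ∑[ x ∈ elements ] g (h x) ≡ ∑ elements g
  ∑-bijection h h⁻¹ left right g = begin
    ∑[ x ∈ elements ] g (h x)                                         ≡⟨ ∑-cong elements (λ x → ∑-point (h x) g) ⟨
    ∑[ x ∈ elements ] ∑[ y ∈ elements ] (𝟙 (does (y ≟ h x)) * g y)   ≡⟨ ∑-comm elements elements _ ⟩
    ∑[ y ∈ elements ] ∑[ x ∈ elements ] (𝟙 (does (y ≟ h x)) * g y)   ≡⟨ ∑-cong elements (λ y → ∑-cong elements (λ x → cong (λ b → 𝟙 b * g y) (flip y x))) ⟩
    ∑[ y ∈ elements ] ∑[ x ∈ elements ] (𝟙 (does (x ≟ h⁻¹ y)) * g y) ≡⟨ ∑-cong elements (λ y → ∑-point (h⁻¹ y) (λ _ → g y)) ⟩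
    ∑ elements g                                                      ∎
    where
    open ≡-Reasoning
    flip : ∀ y x → does (y ≟ h x) ≡ does (x ≟ h⁻¹ y)
    flip y x = does-≡ (map′ (λ y≡hx → trans (sym (left x)) (cong h⁻¹ (sym y≡hx)))
                            (λ x≡h⁻¹y → trans (sym (right y)) (cong h (sym x≡h⁻¹y)))
                            (y ≟ h x))
                      (x ≟ h⁻¹ y)

∑-allFin-suc : ∀ {n} (f : Fin (suc n) → ℕ) → ∑ (allFin (suc n)) f ≡ f fzero + ∑[ i ∈ allFin n ] f (fsuc i)
∑-allFin-suc {n} f = cong (f fzero +_) (trans (cong (λ is → ∑ is f) (sym (map-tabulate id fsuc))) (∑-map fsuc (allFin n) f))

finListing : ∀ n → Listing (Fin n)
finListing n = record { _≟_ = _≟ᶠ′_ ; elements = allFin n ; once = once n }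
  where
  once : ∀ n (j : Fin n) → ∑[ i ∈ allFin n ] 𝟙 (does (i ≟ᶠ′ j)) ≡ 1
  once (suc n) fzero    = trans (∑-allFin-suc {n} (λ i → 𝟙 (does (i ≟ᶠ′ fzero)))) (cong suc (∑-zero (allFin n)))
  once (suc n) (fsuc j) = trans (∑-allFin-suc {n} (λ i → 𝟙 (does (i ≟ᶠ′ fsuc j)))) (once n j)

_×-listing_ : {A B : Set} → Listing A → Listing B → Listing (A × B)
_×-listing_ {A} {B} LA LB = record { _≟_ = _≟×_ ; elements = cartesianProduct (elements LA) (elements LB) ; once = once× }
  where
  open Listing
  _≟×_ : DecidableEquality (A × B)
  (a , b) ≟× (c , d) = map′ (λ (a≡c , b≡d) → cong₂ _,_ a≡c b≡d) (λ e → cong proj₁ e , cong proj₂ e)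
                            (_≟_ LA a c ×-dec _≟_ LB b d)
  𝟙-∧ : ∀ p q → 𝟙 (p ∧ q) ≡ 𝟙 p * 𝟙 q
  𝟙-∧ true  q = sym (+-identityʳ (𝟙 q))
  𝟙-∧ false q = refl
  once× : ∀ y → ∑[ x ∈ cartesianProduct (elements LA) (elements LB) ] 𝟙 (does (x ≟× y)) ≡ 1
  once× (c , d) = begin
    ∑[ x ∈ cartesianProduct (elements LA) (elements LB) ] 𝟙 (does (x ≟× (c , d)))
      ≡⟨ ∑-cartesianProduct (elements LA) (elements LB) _ ⟩
    ∑[ a ∈ elements LA ] ∑[ b ∈ elements LB ] 𝟙 (does (_≟_ LA a c) ∧ does (_≟_ LB b d))
      ≡⟨ ∑-cong (elements LA) (λ a → ∑-cong (elements LB) (λ b → trans (𝟙-∧ (does (_≟_ LA a c)) (does (_≟_ LB b d))) (*-comm (𝟙 (does (_≟_ LA a c))) _))) ⟩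
    ∑[ a ∈ elements LA ] ∑[ b ∈ elements LB ] (𝟙 (does (_≟_ LB b d)) * 𝟙 (does (_≟_ LA a c)))
      ≡⟨ ∑-cong (elements LA) (λ a → ∑-point LB d _) ⟩
    ∑[ a ∈ elements LA ] 𝟙 (does (_≟_ LA a c))
      ≡⟨ once LA c ⟩
    1 ∎
    where open ≡-Reasoning

-- Orbits of a map
first-witness : ∀ {P : ℕ → Set} → (∀ k → Dec (P k)) → ∀ n → P n → ∃[ m ] (P m × ∀ j → j < m → ¬ P j)
first-witness P? zero    p = zero , p , λ _ ()
first-witness P? (suc n) p with P? zero | first-witness (P? ∘ suc) n p
... | yes p0 | _               = zero , p0 , λ _ ()
... | no ¬p0 | m , pm , before = suc m , pm , λ { zero _ → ¬p0 ; (suc j) (s≤s j<m) → before j j<m }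

module _ {A : Set} where

  iter-+ : ∀ (f : A → A) j k x → iter f (j + k) x ≡ iter f j (iter f k x)
  iter-+ f zero    k x = refl
  iter-+ f (suc j) k x = cong f (iter-+ f j k x)

  iter-suc : ∀ (f : A → A) k x → iter f (suc k) x ≡ iter f k (f x)
  iter-suc f k x = trans (cong (λ m → iter f m x) (+-comm 1 k)) (iter-+ f k 1 x)

  iter-cong : ∀ {f g : A → A} → (∀ x → f x ≡ g x) → ∀ k x → iter f k x ≡ iter g k x
  iter-cong f≗g zero    x = refl
  iter-cong {g = g} f≗g (suc k) x = trans (f≗g _) (cong g (iter-cong f≗g k x))

  iter-fixed : ∀ (f : A → A) {x} → f x ≡ x → ∀ k → iter f k x ≡ x
  iter-fixed f fx≡x zero    = refl
  iter-fixed f fx≡x (suc k) = trans (cong f (iter-fixed f fx≡x k)) fx≡x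

  iter-injective : ∀ {f : A → A} → Injective _≡_ _≡_ f → ∀ k {x y} → iter f k x ≡ iter f k y → x ≡ y
  iter-injective f-inj zero    eq = eq
  iter-injective f-inj (suc k) eq = iter-injective f-inj k (f-inj eq)

  iter-% : ∀ (f : A → A) p {x} → iter f (suc p) x ≡ x → ∀ k → iter f k x ≡ iter f (k % suc p) x
  iter-% f p {x} periodic k = begin
    iter f k x                                          ≡⟨ cong (λ m → iter f m x) (m≡m%n+[m/n]*n k (suc p)) ⟩
    iter f (k % suc p + (k / suc p) * suc p) x          ≡⟨ iter-+ f (k % suc p) _ x ⟩
    iter f (k % suc p) (iter f ((k / suc p) * suc p) x) ≡⟨ cong (iter f (k % suc p)) (multiple (k / suc p)) ⟩
    iter f (k % suc p) x                                ∎
    where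
    open ≡-Reasoning
    multiple : ∀ q → iter f (q * suc p) x ≡ x
    multiple zero    = refl
    multiple (suc q) = trans (iter-+ f (suc p) (q * suc p) x) (trans (cong (iter f (suc p)) (multiple q)) periodic)

  record Orbit (f : A → A) (x y : A) : Set where
    constructor orbit
    field
      steps : ℕ
      lands : iter f steps x ≡ y

  orbit-trans : ∀ {f : A → A} {x y z} → Orbit f x y → Orbit f y z → Orbit f x z
  orbit-trans {f} {x} (orbit j refl) (orbit k refl) = orbit (k + j) (iter-+ f k j x)

  -- A return after j + 1 < k steps would reach y after only k - (j + 1) steps.
  first-hit⇒no-return : ∀ (f : A → A) {x y k} → iter f k x ≡ y → (∀ j → j < k → iter f j x ≢ y) →
                        ∀ j → j < k → iter f (suc j) x ≢ x
  first-hit⇒no-return f {x} {y} {k} hit first j j<k return = first (k ∸ suc j) (∸-monoʳ-< z<s j<k) shortcut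
    where
    shortcut : iter f (k ∸ suc j) x ≡ y
    shortcut = begin
      iter f (k ∸ suc j) x                     ≡⟨ cong (iter f (k ∸ suc j)) return ⟨
      iter f (k ∸ suc j) (iter f (suc j) x)    ≡⟨ iter-+ f (k ∸ suc j) (suc j) x ⟨
      iter f (k ∸ suc j + suc j) x             ≡⟨ cong (λ m → iter f m x) (m∸n+n≡m j<k) ⟩
      iter f k x                               ≡⟨ hit ⟩
      y                                        ∎
      where open ≡-Reasoning

-- Cycles of a permutation
module Transpositions {A : Set} (_≟_ : DecidableEquality A) where

  transpose : A → A → A → A
  transpose a b x with x ≟ a | x ≟ b
  ... | yes _ | _     = b
  ... | no _  | yes _ = a
  ... | no _  | no _  = x

  transpose-a : ∀ a b → transpose a b a ≡ b
  transpose-a a b with a ≟ a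
  ... | yes _  = refl
  ... | no a≢a = contradiction refl a≢a

  transpose-b : ∀ {a b} → a ≢ b → transpose a b b ≡ a
  transpose-b {a} {b} a≢b with b ≟ a | b ≟ b
  ... | yes b≡a | _      = contradiction (sym b≡a) a≢b
  ... | no _    | yes _  = refl
  ... | no _    | no b≢b = contradiction refl b≢b

  transpose-other : ∀ {a b x} → x ≢ a → x ≢ b → transpose a b x ≡ x
  transpose-other {a} {b} {x} x≢a x≢b with x ≟ a | x ≟ b
  ... | yes x≡a | _       = contradiction x≡a x≢a
  ... | no _    | yes x≡b = contradiction x≡b x≢b
  ... | no _    | no _    = refl

  transpose-involutive : ∀ {a b} → a ≢ b → ∀ x → transpose a b (transpose a b x) ≡ x
  transpose-involutive {a} {b} a≢b x with x ≟ a | x ≟ b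
  ... | yes refl | _        = transpose-b a≢b
  ... | no _     | yes refl = transpose-a a x
  ... | no x≢a   | no x≢b   = transpose-other x≢a x≢b

  transpose-comm : ∀ {a b} → a ≢ b → ∀ x → transpose b a x ≡ transpose a b x
  transpose-comm {a} {b} a≢b x = by-cases (x ≟ a) (x ≟ b)
    where
    by-cases : Dec (x ≡ a) → Dec (x ≡ b) → transpose b a x ≡ transpose a b x
    by-cases (yes x≡a) _         = trans (cong (transpose b a) x≡a) (trans (transpose-b (a≢b ∘ sym))
                                     (sym (trans (cong (transpose a b) x≡a) (transpose-a a b))))
    by-cases (no _)    (yes x≡b) = trans (cong (transpose b a) x≡b) (trans (transpose-a b a)
                                     (sym (trans (cong (transpose a b) x≡b) (transpose-b a≢b))))
    by-cases (no x≢a)  (no x≢b)  = trans (transpose-other x≢b x≢a) (sym (transpose-other x≢a x≢b))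

  transpose-injective : ∀ {a b} → a ≢ b → Injective _≡_ _≡_ (transpose a b)
  transpose-injective a≢b {x} {y} eq =
    trans (sym (transpose-involutive a≢b x)) (trans (cong (transpose _ _) eq) (transpose-involutive a≢b y))

  transposeAll : List (A × A) → A → A
  transposeAll []             = id
  transposeAll ((a , b) ∷ ts) = transposeAll ts ∘ transpose a b

  Distinct : A × A → Set
  Distinct (a , b) = a ≢ b

  transposeAll-injective : ∀ ts → All Distinct ts → Injective _≡_ _≡_ (transposeAll ts)
  transposeAll-injective []             []            = id
  transposeAll-injective ((a , b) ∷ ts) (a≢b ∷ dist) eq = transpose-injective a≢b (transposeAll-injective ts dist eq)

module Cycles {A : Set} (L : Listing A) {M : ℕ} (enc : A → Fin M) (enc-injective : Injective _≡_ _≡_ enc) where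
  open Listing L
  open Transpositions _≟_

  rank : A → ℕ
  rank = toℕ ∘ enc

  -- x represents its cycle when it has the least rank on it; the cycle of an injection has at most M points,
  -- so M iterates suffice.
  isRepᵇ : (A → A) → A → Bool
  isRepᵇ f x = allᵇ (λ k → rank x ≤ᵇ rank (iter f k x)) (upTo M)

  cycles : (A → A) → ℕ
  cycles f = ∑[ x ∈ elements ] 𝟙 (isRepᵇ f x)

  isRepᵇ-cong : ∀ {f g : A → A} → (∀ x → f x ≡ g x) → ∀ x → isRepᵇ f x ≡ isRepᵇ g x
  isRepᵇ-cong f≗g x = allᵇ-cong (λ k → cong (λ y → rank x ≤ᵇ rank y) (iter-cong f≗g k x)) (upTo M)

  cycles-cong : ∀ {f g : A → A} → (∀ x → f x ≡ g x) → cycles f ≡ cycles g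
  cycles-cong f≗g = ∑-cong elements (cong 𝟙 ∘ isRepᵇ-cong f≗g)

  fixed⇒isRep : ∀ (f : A → A) {x} → f x ≡ x → isRepᵇ f x ≡ true
  fixed⇒isRep f {x} fx≡x = allᵇ-complete _ (upTo M) λ {k} _ →
    ≤ᵇ-complete (≤-reflexive (cong rank (sym (iter-fixed f fx≡x k))))

  module Injection {f : A → A} (f-injective : Injective _≡_ _≡_ f) where

    period : ∀ x → ∃[ p ] (iter f (suc p) x ≡ x × suc p ≤ M)
    period x with pigeonhole (n<1+n M) (λ (i : Fin (suc M)) → enc (iter f (toℕ i) x))
    ... | i , j , i<j , same-rank = p , returns , p<M
      where
      p : ℕ
      p = toℕ j ∸ suc (toℕ i)
      i+suc[p]≡j : toℕ i + suc p ≡ toℕ j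
      i+suc[p]≡j = trans (+-suc (toℕ i) p) (m+[n∸m]≡n i<j)
      returns : iter f (suc p) x ≡ x
      returns = sym (iter-injective f-injective (toℕ i) (begin
        iter f (toℕ i) x                  ≡⟨ enc-injective same-rank ⟩
        iter f (toℕ j) x                  ≡⟨ cong (λ m → iter f m x) i+suc[p]≡j ⟨
        iter f (toℕ i + suc p) x          ≡⟨ iter-+ f (toℕ i) (suc p) x ⟩
        iter f (toℕ i) (iter f (suc p) x) ∎))
        where open ≡-Reasoning
      p<M : suc p ≤ M
      p<M = ≤-trans (m≤n+m (suc p) (toℕ i)) (≤-trans (≤-reflexive i+suc[p]≡j) (≤-pred (toℕ<n j)))

    orbit-bounded : ∀ {x y} → Orbit f x y → ∃[ k ] (k < M × iter f k x ≡ y)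
    orbit-bounded {x} (orbit k refl) with period x
    ... | p , returns , p<M = k % suc p , <-≤-trans (m%n<n k (suc p)) p<M , sym (iter-% f p returns k)

    orbit-sym : ∀ {x y} → Orbit f x y → Orbit f y x
    orbit-sym {x} (orbit k refl) with period x
    ... | p , returns , _ = orbit (suc p ∸ k % suc p) (begin
      iter f (suc p ∸ r) (iter f k x) ≡⟨ cong (iter f (suc p ∸ r)) (iter-% f p returns k) ⟩
      iter f (suc p ∸ r) (iter f r x) ≡⟨ iter-+ f (suc p ∸ r) r x ⟨
      iter f (suc p ∸ r + r) x        ≡⟨ cong (λ m → iter f m x) (m∸n+n≡m (<⇒≤ (m%n<n k (suc p)))) ⟩
      iter f (suc p) x                ≡⟨ returns ⟩
      x                               ∎)
      where
      open ≡-Reasoning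
      r : ℕ
      r = k % suc p

    orbit? : ∀ x y → Dec (Orbit f x y)
    orbit? x y = map′ (λ (k , hit) → orbit (toℕ k) hit) bounded (any? λ (k : Fin M) → iter f (toℕ k) x ≟ y)
      where
      bounded : Orbit f x y → ∃ λ (k : Fin M) → iter f (toℕ k) x ≡ y
      bounded o with orbit-bounded o
      ... | k , k<M , hit = fromℕ< k<M , trans (cong (λ m → iter f m x) (toℕ-fromℕ< k<M)) hit

    preimage : A → A
    preimage y = iter f (proj₁ (period y)) y

    f∘preimage : ∀ y → f (preimage y) ≡ y
    f∘preimage y = proj₁ (proj₂ (period y))

    preimage∘f : ∀ x → preimage (f x) ≡ x
    preimage∘f x = f-injective (f∘preimage (f x))

    isRep⇒minimal : ∀ {x y} → isRepᵇ f x ≡ true → Orbit f x y → rank x ≤ rank y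
    isRep⇒minimal {x} rep o with orbit-bounded o
    ... | k , k<M , refl = ≤ᵇ-sound (allᵇ-sound (λ k → rank x ≤ᵇ rank (iter f k x)) rep (∈-upTo⁺ k<M))

    minimal⇒isRep : ∀ {x} → (∀ y → Orbit f x y → rank x ≤ rank y) → isRepᵇ f x ≡ true
    minimal⇒isRep minimal = allᵇ-complete _ (upTo M) λ {k} _ → ≤ᵇ-complete (minimal _ (orbit k refl))

    rep-unique : ∀ {r r′} → isRepᵇ f r ≡ true → isRepᵇ f r′ ≡ true → Orbit f r r′ → r ≡ r′
    rep-unique rep rep′ o =
      enc-injective (toℕ-injective (≤-antisym (isRep⇒minimal rep o) (isRep⇒minimal rep′ (orbit-sym o))))

    rep-exists : ∀ x → ∃[ r ] (Orbit f x r × isRepᵇ f r ≡ true)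
    rep-exists x = r , x↝r , minimal⇒isRep r-minimal
      where
      iterates : List A
      iterates = applyUpTo (λ k → iter f k x) M
      r : A
      r = argmin rank x iterates
      x↝r : Orbit f x r
      x↝r with argmin-sel rank x iterates
      ... | inj₁ r≡x = orbit 0 (sym r≡x)
      ... | inj₂ r∈ with ∈-applyUpTo⁻ _ r∈
      ...   | k , _ , r≡ = orbit k (sym r≡)
      r-minimal : ∀ y → Orbit f r y → rank r ≤ rank y
      r-minimal y r↝y with orbit-bounded (orbit-trans x↝r r↝y)
      ... | k , k<M , refl = All.lookup (f[argmin]≤f[xs] {f = rank} x iterates) (∈-applyUpTo⁺ _ k<M)

    one-rep-per-orbit : ∀ x → ∑[ y ∈ elements ] 𝟙 (isRepᵇ f y ∧ does (orbit? x y)) ≡ 1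
    one-rep-per-orbit x with rep-exists x
    ... | r , x↝r , rep = ∑-𝟙-unique L (λ y → isRepᵇ f y ∧ does (orbit? x y)) r only-r r-counts
      where
      r-counts : (isRepᵇ f r ∧ does (orbit? x r)) ≡ true
      r-counts rewrite rep = dec-true (orbit? x r) x↝r
      only-r : ∀ y → (isRepᵇ f y ∧ does (orbit? x y)) ≡ true → y ≡ r
      only-r y counts with isRepᵇ f y in rep-y | does (orbit? x y) in x↝y
      ... | true | true = rep-unique rep-y rep (orbit-trans (orbit-sym (does-sound (orbit? x y) x↝y)) x↝r)

    module _ (p : A → Bool) (closed : ∀ x → p x ≡ true → p (f x) ≡ true)
             (no-fixed-point : ∀ x → p x ≡ true → f x ≢ x) (no-2-cycle : ∀ x → p x ≡ true → f (f x) ≢ x) where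

      private
        R : A → Bool
        R x = p x ∧ isRepᵇ f x

        R⇒p : ∀ {x} → R x ≡ true → p x ≡ true
        R⇒p {x} Rx with p x
        ... | true = refl

        R⇒rep : ∀ {x} → R x ≡ true → isRepᵇ f x ≡ true
        R⇒rep {x} Rx with p x
        ... | true = Rx

        g : A → A
        g = preimage

        f²∘g² : ∀ y → f (f (g (g y))) ≡ y
        f²∘g² y = trans (cong f (f∘preimage (g y))) (f∘preimage y)

        at-most-one : ∀ y → 𝟙 (R y) + 𝟙 (R (g y)) + 𝟙 (R (g (g y))) ≤ 𝟙 (p y)
        at-most-one y = 𝟙-disjoint-≤ R⇒p
          (λ Rgy → subst (λ z → p z ≡ true) (f∘preimage y) (closed _ (R⇒p Rgy)))
          (λ Rggy → subst (λ z → p z ≡ true) (f²∘g² y) (closed _ (closed _ (R⇒p Rggy))))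
          (λ Ry Rgy → no-fixed-point y (R⇒p Ry) (trans (cong f (sym (g≡ Rgy Ry (orbit 1 (f∘preimage y))))) (f∘preimage y)))
          (λ Ry Rggy → no-2-cycle y (R⇒p Ry) (trans (cong (f ∘ f) (sym (g≡ Rggy Ry (orbit 2 (f²∘g² y))))) (f²∘g² y)))
          (λ Rgy Rggy → no-fixed-point (g y) (R⇒p Rgy) (trans (cong f (sym (g≡ Rggy Rgy (orbit 1 (f∘preimage (g y)))))) (f∘preimage (g y))))
          where
          g≡ : ∀ {x y} → R x ≡ true → R y ≡ true → Orbit f x y → x ≡ y
          g≡ Rx Ry = rep-unique (R⇒rep Rx) (R⇒rep Ry)

      -- Representatives, their preimages and their second preimages form three disjoint sets of equal size,
      -- as there are no cycles of length 1 or 2.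
      3*cycles≤support : 3 * ∑[ x ∈ elements ] 𝟙 (R x) ≤ ∑[ x ∈ elements ] 𝟙 (p x)
      3*cycles≤support = begin
        3 * C                                                        ≡⟨ cong (λ c → C + (C + c)) (+-identityʳ C) ⟩
        C + (C + C)                                                  ≡⟨ +-assoc C C C ⟨
        C + C + C                                                    ≡⟨ cong₂ (λ a b → C + a + b) (sym (∑-bijection L g f f∘preimage preimage∘f (𝟙 ∘ R)))
                                                                                                 (sym (∑-bijection L (g ∘ g) (f ∘ f) f²∘g² g²∘f² (𝟙 ∘ R))) ⟩
        C + ∑[ y ∈ elements ] 𝟙 (R (g y)) + ∑[ y ∈ elements ] 𝟙 (R (g (g y)))
                                                                     ≡⟨ cong (_+ ∑[ y ∈ elements ] 𝟙 (R (g (g y)))) (∑-distrib-+ elements (𝟙 ∘ R) (𝟙 ∘ R ∘ g)) ⟨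
        ∑[ y ∈ elements ] (𝟙 (R y) + 𝟙 (R (g y))) + ∑[ y ∈ elements ] 𝟙 (R (g (g y)))
                                                                     ≡⟨ ∑-distrib-+ elements _ (𝟙 ∘ R ∘ g ∘ g) ⟨
        ∑[ y ∈ elements ] (𝟙 (R y) + 𝟙 (R (g y)) + 𝟙 (R (g (g y)))) ≤⟨ ∑-mono-≤ elements at-most-one ⟩
        ∑[ y ∈ elements ] 𝟙 (p y)                                    ∎
        where
        open ≤-Reasoning
        C : ℕ
        C = ∑[ x ∈ elements ] 𝟙 (R x)
        g²∘f² : ∀ y → g (g (f (f y))) ≡ y
        g²∘f² y = trans (cong g (preimage∘f (f y))) (preimage∘f y)

  cycles-off-support : ∀ (f : A → A) (p : A → Bool) → (∀ x → p x ≡ false → f x ≡ x) →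
                       cycles f ≡ ∑[ x ∈ elements ] 𝟙 (p x ∧ isRepᵇ f x) + ∑[ x ∈ elements ] 𝟙 (not (p x))
  cycles-off-support f p fixed = trans (∑-cong elements split) (∑-distrib-+ elements _ _)
    where
    split : ∀ x → 𝟙 (isRepᵇ f x) ≡ 𝟙 (p x ∧ isRepᵇ f x) + 𝟙 (not (p x))
    split x with p x in px
    ... | true  = sym (+-identityʳ _)
    ... | false = cong 𝟙 (fixed⇒isRep f (fixed x px))

  cycles-split : ∀ (f : A → A) (q : A → Bool) →
                 cycles f ≡ ∑[ x ∈ elements ] 𝟙 (isRepᵇ f x ∧ q x) + ∑[ x ∈ elements ] 𝟙 (isRepᵇ f x ∧ not (q x))
  cycles-split f q = trans (∑-cong elements split) (∑-distrib-+ elements _ _)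
    where
    split : ∀ x → 𝟙 (isRepᵇ f x) ≡ 𝟙 (isRepᵇ f x ∧ q x) + 𝟙 (isRepᵇ f x ∧ not (q x))
    split x with isRepᵇ f x | q x
    ... | true  | true  = refl
    ... | true  | false = refl
    ... | false | _     = refl

  module Transposition {f : A → A} (f-injective : Injective _≡_ _≡_ f) where
    open Injection f-injective

    agree : ∀ {a b x} k → (∀ j → j < k → iter f j x ≢ a × iter f j x ≢ b) →
            iter (f ∘ transpose a b) k x ≡ iter f k x
    agree zero    avoids = refl
    agree (suc k) avoids = trans (cong (f ∘ transpose _ _) (agree k (λ j j<k → avoids j (m<n⇒m<1+n j<k))))
                                 (cong f (transpose-other (proj₁ (avoids k ≤-refl)) (proj₂ (avoids k ≤-refl))))

    -- (f ∘ transpose a b) b = f a, and from f a the old orbit of a reaches y before passing through a or b.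
    entering : ∀ {a b} → ¬ Orbit f a b → ∀ {y} → Orbit f a y → Orbit (f ∘ transpose a b) b y
    entering {a} {b} apart {y} a↝y with orbit-trans (orbit-sym (orbit 1 refl)) a↝y
    ... | orbit n fa↝y with first-witness (λ k → iter f k (f a) ≟ y) n fa↝y
    ... | k , hit , first = orbit (suc k) (begin
      iter f′ (suc k) b ≡⟨ iter-suc f′ k b ⟩
      iter f′ k (f′ b)  ≡⟨ cong (iter f′ k ∘ f) (transpose-b (λ a≡b → apart (orbit 0 a≡b))) ⟩
      iter f′ k (f a)   ≡⟨ agree k avoids ⟩
      iter f k (f a)    ≡⟨ hit ⟩
      y                 ∎)
      where
      open ≡-Reasoning
      f′ : A → A
      f′ = f ∘ transpose a b
      avoids : ∀ j → j < k → iter f j (f a) ≢ a × iter f j (f a) ≢ b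
      avoids j j<k = (λ e → first-hit⇒no-return f hit first j j<k (cong f e))
                   , (λ e → apart (orbit (suc j) (trans (iter-suc f j a) e)))

    splitting : ∀ {a b} → a ≢ b → Orbit f a b → ¬ Orbit (f ∘ transpose a b) a b
    splitting {a} {b} a≢b a↝b (orbit m hit′) with orbit-trans (orbit-sym (orbit 1 refl)) (orbit-sym a↝b)
    ... | orbit n fb↝a with first-witness (λ k → iter f k (f b) ≟ a) n fb↝a
    ... | k , hit , first = never-b (m % suc k) (m%n<n m (suc k)) (trans (sym (iter-% f′ k returns m)) hit′)
      where
      f′ : A → A
      f′ = f ∘ transpose a b
      no-return : ∀ j → j < k → iter f (suc j) (f b) ≢ f b
      no-return = first-hit⇒no-return f hit first
      along : ∀ j → j ≤ k → iter f′ (suc j) a ≡ iter f j (f b)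
      along j j≤k = trans (iter-suc f′ j a) (trans (cong (iter f′ j ∘ f) (transpose-a a b)) (agree j avoids))
        where
        avoids : ∀ i → i < j → iter f i (f b) ≢ a × iter f i (f b) ≢ b
        avoids i i<j = first i (<-≤-trans i<j j≤k) , λ e → no-return i (<-≤-trans i<j j≤k) (cong f e)
      returns : iter f′ (suc k) a ≡ a
      returns = trans (along k ≤-refl) hit
      never-b : ∀ r → r < suc k → iter f′ r a ≢ b
      never-b zero    _         = a≢b
      never-b (suc r) (s≤s r<k) e = no-return r r<k (cong f (trans (sym (along r (<⇒≤ r<k))) e))

    module Merging {a b} (apart : ¬ Orbit f a b) where
      a≢b : a ≢ b
      a≢b a≡b = apart (orbit 0 a≡b)

      f′ : A → A
      f′ = f ∘ transpose a b

      module I′ = Injection {f′} (λ eq → transpose-injective a≢b (f-injective eq))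

      entering-a : ∀ {y} → Orbit f b y → Orbit f′ a y
      entering-a {y} b↝y = orbit (steps via-b) (trans (iter-cong transpose-swap (steps via-b) a) (lands via-b))
        where
        open Orbit
        via-b : Orbit (f ∘ transpose b a) a y
        via-b = entering (λ b↝a → apart (orbit-sym b↝a)) b↝y
        transpose-swap : ∀ x → f′ x ≡ f (transpose b a x)
        transpose-swap x = cong f (sym (transpose-comm a≢b x))

      outside-agree : ∀ {y} → ¬ Orbit f a y → ¬ Orbit f b y → ∀ k → iter f′ k y ≡ iter f k y
      outside-agree ¬a↝y ¬b↝y k = agree k λ j _ → (λ e → ¬a↝y (orbit-sym (orbit j e))) , (λ e → ¬b↝y (orbit-sym (orbit j e)))

      joined : A → Bool
      joined y = does (orbit? a y) ∨ does (orbit? b y)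

      orbit′-a : ∀ y → does (I′.orbit? a y) ≡ joined y
      orbit′-a y = by-cases (orbit? a y) (orbit? b y) (I′.orbit? a y)
        where
        by-cases : (a↝y? : Dec (Orbit f a y)) (b↝y? : Dec (Orbit f b y)) (a↝′y? : Dec (Orbit f′ a y)) →
                   does a↝′y? ≡ does a↝y? ∨ does b↝y?
        by-cases (yes a↝y) _ a↝′y? = dec-true a↝′y? (orbit-trans (entering-a (orbit 0 refl)) (entering apart a↝y))
        by-cases (no _) (yes b↝y) a↝′y? = dec-true a↝′y? (entering-a b↝y)
        by-cases (no ¬a↝y) (no ¬b↝y) a↝′y? = dec-false a↝′y? λ a↝′y → let orbit k hit = I′.orbit-sym a↝′y in
          ¬a↝y (orbit-sym (orbit k (trans (sym (outside-agree ¬a↝y ¬b↝y k)) hit)))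

      reps-outside : ∀ y → 𝟙 (isRepᵇ f′ y ∧ not (joined y)) ≡ 𝟙 (isRepᵇ f y ∧ not (joined y))
      reps-outside y = by-cases (orbit? a y) (orbit? b y)
        where
        by-cases : (a↝y? : Dec (Orbit f a y)) (b↝y? : Dec (Orbit f b y)) →
                   𝟙 (isRepᵇ f′ y ∧ not (does a↝y? ∨ does b↝y?)) ≡ 𝟙 (isRepᵇ f y ∧ not (does a↝y? ∨ does b↝y?))
        by-cases (yes _) _ = cong 𝟙 (trans (∧-zeroʳ _) (sym (∧-zeroʳ _)))
        by-cases (no _) (yes _) = cong 𝟙 (trans (∧-zeroʳ _) (sym (∧-zeroʳ _)))
        by-cases (no ¬a↝y) (no ¬b↝y) = cong (λ r → 𝟙 (r ∧ true))
          (allᵇ-cong (λ k → cong (λ z → rank y ≤ᵇ rank z) (outside-agree ¬a↝y ¬b↝y k)) (upTo M))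

      two-reps-inside : ∑[ y ∈ elements ] 𝟙 (isRepᵇ f y ∧ joined y) ≡ 2
      two-reps-inside = trans (∑-cong elements split) (trans (∑-distrib-+ elements _ _)
                              (cong₂ _+_ (one-rep-per-orbit a) (one-rep-per-orbit b)))
        where
        split : ∀ y → 𝟙 (isRepᵇ f y ∧ joined y) ≡ 𝟙 (isRepᵇ f y ∧ does (orbit? a y)) + 𝟙 (isRepᵇ f y ∧ does (orbit? b y))
        split y = 𝟙-∧-∨ (isRepᵇ f y) _ _ λ a↝y b↝y →
          apart (orbit-trans (does-sound (orbit? a y) a↝y) (orbit-sym (does-sound (orbit? b y) b↝y)))

      one-rep-inside : ∑[ y ∈ elements ] 𝟙 (isRepᵇ f′ y ∧ joined y) ≡ 1
      one-rep-inside = trans (∑-cong elements λ y → cong (λ o → 𝟙 (isRepᵇ f′ y ∧ o)) (sym (orbit′-a y)))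
                             (I′.one-rep-per-orbit a)

      outside : (A → A) → ℕ
      outside g = ∑[ y ∈ elements ] 𝟙 (isRepᵇ g y ∧ not (joined y))

      merge : cycles f ≡ suc (cycles f′)
      merge = begin
        cycles f                                                         ≡⟨ cycles-split f joined ⟩
        ∑[ y ∈ elements ] 𝟙 (isRepᵇ f y ∧ joined y) + outside f           ≡⟨ cong (_+ outside f) two-reps-inside ⟩
        2 + outside f                                                    ≡⟨ cong (2 +_) (∑-cong elements reps-outside) ⟨
        2 + outside f′                                                   ≡⟨ cong (λ c → suc (c + outside f′)) one-rep-inside ⟨
        suc (∑[ y ∈ elements ] 𝟙 (isRepᵇ f′ y ∧ joined y) + outside f′)   ≡⟨ cong suc (cycles-split f′ joined) ⟨
        suc (cycles f′)                                                  ∎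
        where open ≡-Reasoning

  cycles-transpose : ∀ {f : A → A} → Injective _≡_ _≡_ f → ∀ {a b} → a ≢ b →
                     even (cycles (f ∘ transpose a b)) ≡ not (even (cycles f))
  cycles-transpose {f} f-injective {a} {b} a≢b with Injection.orbit? f-injective a b
  ... | no apart = sym (trans (cong (not ∘ even) (Merging.merge apart)) (not-involutive _))
    where open Transposition f-injective
  ... | yes a↝b  = cong even (trans (Merging.merge (splitting a≢b a↝b))
                                    (cong suc (cycles-cong λ x → cong f (transpose-involutive a≢b x))))
    where
    open Transposition f-injective using (splitting)
    open Transposition (λ eq → transpose-injective a≢b (f-injective eq)) using (module Merging)


  cycles-transposeAll : ∀ {f : A → A} → Injective _≡_ _≡_ f → ∀ ts → All Distinct ts →
                        even (cycles (f ∘ transposeAll ts)) ≡ even (length ts + cycles f)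
  cycles-transposeAll f-injective []             []            = refl
  cycles-transposeAll f-injective ((a , b) ∷ ts) (a≢b ∷ dist) =
    trans (cycles-transpose (λ eq → transposeAll-injective ts dist (f-injective eq)) a≢b)
          (cong not (cycles-transposeAll f-injective ts dist))

-- Rotation systems
pairListing : ∀ n → Listing (Fin n × Fin n)
pairListing n = finListing n ×-listing finListing n

combine-injective₂ : ∀ {n} → Injective _≡_ _≡_ (λ (x : Fin n × Fin n) → combine (proj₁ x) (proj₂ x))
combine-injective₂ {x = u , v} {y = u′ , v′} eq = ×-≡,≡→≡ (combine-injective u v u′ v′ eq)

module DartTranspositions {n : ℕ} = Transpositions (Listing._≟_ (pairListing n))
open DartTranspositions using (transposeAll; Distinct)

-- A dart is a pair (u, v) with G u v; the permutations of darts below fix every other pair.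
reverse : ∀ {n} → Graph n → Fin n × Fin n → Fin n × Fin n
reverse G (u , v) = if G u v then (v , u) else (u , v)

isDart : ∀ {n} → Graph n → Fin n × Fin n → Bool
isDart G (u , v) = G u v

edgeReversals : ∀ {n} → Graph n → List ((Fin n × Fin n) × (Fin n × Fin n))
edgeReversals {n} G = map (λ (u , v) → (u , v) , (v , u)) (filterᵇ (λ (u , v) → G u v ∧ (toℕ u <ᵇ toℕ v)) (pairs n))

numEdges≡ : ∀ {n} (G : Graph n) → numEdges G ≡ ∑[ x ∈ pairs n ] 𝟙 (G (proj₁ x) (proj₂ x) ∧ (toℕ (proj₁ x) <ᵇ toℕ (proj₂ x)))
numEdges≡ {n} G = trans (length-filterᵇ _ (pairs n)) (∑-cong (pairs n) λ (u , v) → refl)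

length-edgeReversals : ∀ {n} (G : Graph n) → length (edgeReversals G) ≡ numEdges G
length-edgeReversals {n} G = begin
  length (edgeReversals G)                                  ≡⟨ length-map _ (filterᵇ _ (pairs n)) ⟩
  length (filterᵇ (λ (u , v) → G u v ∧ (toℕ u <ᵇ toℕ v)) (pairs n)) ≡⟨ length-filterᵇ _ (pairs n) ⟩
  ∑[ x ∈ pairs n ] 𝟙 (G (proj₁ x) (proj₂ x) ∧ (toℕ (proj₁ x) <ᵇ toℕ (proj₂ x))) ≡⟨ numEdges≡ G ⟨
  numEdges G                                                ∎
  where open ≡-Reasoning

-- Every edge {u, v} gives the two darts (u, v) and (v, u), exactly one of which has toℕ u < toℕ v.
darts≡2*edges : ∀ {n} (G : Graph n) → (∀ u v → G u v ≡ G v u) → (∀ v → G v v ≡ false) →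
                ∑[ x ∈ pairs n ] 𝟙 (isDart G x) ≡ 2 * numEdges G
darts≡2*edges {n} G symmetric loopless = begin
  ∑[ x ∈ pairs n ] 𝟙 (isDart G x)                          ≡⟨ ∑-cong (pairs n) (λ (u , v) → split u v) ⟩
  ∑[ x ∈ pairs n ] (𝟙 (increasing x) + 𝟙 (decreasing x))   ≡⟨ ∑-distrib-+ (pairs n) _ _ ⟩
  ∑[ x ∈ pairs n ] 𝟙 (increasing x) + ∑[ x ∈ pairs n ] 𝟙 (decreasing x) ≡⟨ cong₂ _+_ (numEdges≡ G) (sym mirror) ⟨
  numEdges G + numEdges G                                  ≡⟨ cong (numEdges G +_) (+-identityʳ (numEdges G)) ⟨
  2 * numEdges G                                           ∎
  where
  open ≡-Reasoning
  increasing decreasing : Fin n × Fin n → Bool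
  increasing (u , v) = G u v ∧ (toℕ u <ᵇ toℕ v)
  decreasing (u , v) = G u v ∧ (toℕ v <ᵇ toℕ u)

  split : ∀ u v → 𝟙 (G u v) ≡ 𝟙 (increasing (u , v)) + 𝟙 (decreasing (u , v))
  split u v with G u v in uv | toℕ u <ᵇ toℕ v in u<v | toℕ v <ᵇ toℕ u in v<u
  ... | false | _     | _     = refl
  ... | true  | true  | false = refl
  ... | true  | false | true  = refl
  ... | true  | true  | true  = ⊥-elim (<-asym (<ᵇ⇒< (toℕ u) (toℕ v) (subst T (sym u<v) _)) (<ᵇ⇒< (toℕ v) (toℕ u) (subst T (sym v<u) _)))
  ... | true  | false | false = contradiction (trans (sym (loopless u)) (trans (cong (G u) u≡v) uv)) λ ()
    where
    u≡v : u ≡ v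
    u≡v = toℕ-injective (≤-antisym (≮⇒≥ (λ v<u′ → subst T v<u (<⇒<ᵇ v<u′))) (≮⇒≥ (λ u<v′ → subst T u<v (<⇒<ᵇ u<v′))))

  mirror : ∑[ x ∈ pairs n ] 𝟙 (decreasing x) ≡ numEdges G
  mirror = begin
    ∑[ x ∈ pairs n ] 𝟙 (decreasing x)                                         ≡⟨ ∑-cartesianProduct (allFin n) (allFin n) _ ⟩
    ∑[ u ∈ allFin n ] ∑[ v ∈ allFin n ] 𝟙 (G u v ∧ (toℕ v <ᵇ toℕ u))          ≡⟨ ∑-comm (allFin n) (allFin n) _ ⟩
    ∑[ v ∈ allFin n ] ∑[ u ∈ allFin n ] 𝟙 (G u v ∧ (toℕ v <ᵇ toℕ u))          ≡⟨ ∑-cong (allFin n) (λ v → ∑-cong (allFin n) λ u → cong (λ b → 𝟙 (b ∧ (toℕ v <ᵇ toℕ u))) (symmetric u v)) ⟩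
    ∑[ v ∈ allFin n ] ∑[ u ∈ allFin n ] 𝟙 (increasing (v , u))                ≡⟨ ∑-cartesianProduct (allFin n) (allFin n) _ ⟨
    ∑[ x ∈ pairs n ] 𝟙 (increasing x)                                         ≡⟨ numEdges≡ G ⟨
    numEdges G                                                                ∎

non-edge⇒¬complete : ∀ {n} {G : Graph n} u v → u ≢ v → G u v ≡ false → ¬ IsComplete G
non-edge⇒¬complete u v u≢v non-adjacent complete = contradiction (trans (sym non-adjacent) (complete u v u≢v)) λ ()

MinDegree≥2 : ∀ {n} → Graph n → Set
MinDegree≥2 G = ∀ v → ∃[ u ] ∃[ w ] (Adj G v u × Adj G v w × u ≢ w)

module Embedding {n} {G : Graph n} (symmetric : ∀ u v → G u v ≡ G v u) (loopless : ∀ v → G v v ≡ false) where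
  open Cycles (pairListing n) (λ (x : Fin n × Fin n) → combine (proj₁ x) (proj₂ x)) combine-injective₂

  reverse-involutive : ∀ x → reverse G (reverse G x) ≡ x
  reverse-involutive (u , v) with G u v in uv
  ... | true  rewrite symmetric v u | uv = refl
  ... | false rewrite uv = refl

  module _ (R : Rotation G) where
    open Rotation R

    rotate : Fin n × Fin n → Fin n × Fin n
    rotate (v , u) = if G v u then (v , ρ v u) else (v , u)

    face : Fin n × Fin n → Fin n × Fin n
    face = rotate ∘ reverse G

    face-dart : ∀ {u v} → Adj G u v → face (u , v) ≡ (v , ρ v u)
    face-dart {u} {v} uv rewrite uv | symmetric v u | uv = refl

    face-non-dart : ∀ x → isDart G x ≡ false → face x ≡ x
    face-non-dart (u , v) uv rewrite uv | uv = refl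

    rotate-non-dart : ∀ x → isDart G x ≡ false → rotate x ≡ x
    rotate-non-dart (u , v) uv rewrite uv = refl

    face-preserves-darts : ∀ x → isDart G x ≡ true → isDart G (face x) ≡ true
    face-preserves-darts (u , v) uv rewrite face-dart uv = closed v u (trans (symmetric v u) uv)

    iter-ρ-adj : ∀ {v u} → Adj G v u → ∀ k → Adj G v (iter (ρ v) k u)
    iter-ρ-adj vu zero    = vu
    iter-ρ-adj vu (suc k) = closed _ _ (iter-ρ-adj vu k)

    ρ-injective : ∀ {v u u′} → Adj G v u → Adj G v u′ → ρ v u ≡ ρ v u′ → u ≡ u′
    ρ-injective {v} {u} {u′} vu vu′ same with cyclic v (ρ v u) u (closed v u vu) vu | cyclic v u u′ vu vu′
    ... | k , back | j , u↝u′ = begin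
      u                                   ≡⟨ back ⟨
      iter (ρ v) k (ρ v u)                ≡⟨ cong (iter (ρ v) k) same ⟩
      iter (ρ v) k (ρ v u′)               ≡⟨ iter-suc (ρ v) k u′ ⟨
      iter (ρ v) (suc k) u′               ≡⟨ cong (iter (ρ v) (suc k)) u↝u′ ⟨
      iter (ρ v) (suc k) (iter (ρ v) j u) ≡⟨ iter-+ (ρ v) (suc k) j u ⟨
      iter (ρ v) (suc k + j) u            ≡⟨ cong (λ m → iter (ρ v) m u) (+-comm (suc k) j) ⟩
      iter (ρ v) (j + suc k) u            ≡⟨ iter-+ (ρ v) j (suc k) u ⟩
      iter (ρ v) j (iter (ρ v) (suc k) u) ≡⟨ cong (iter (ρ v) j) (trans (iter-suc (ρ v) k u) back) ⟩
      iter (ρ v) j u                      ≡⟨ u↝u′ ⟩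
      u′                                  ∎
      where open ≡-Reasoning

    rotate-injective : Injective _≡_ _≡_ rotate
    rotate-injective {v , u} {v′ , u′} eq with G v u in vu | G v′ u′ in vu′
    ... | false | false = eq
    ... | true  | true  with refl , ρu≡ρu′ ← ,-injective eq = cong (v ,_) (ρ-injective vu vu′ ρu≡ρu′)
    ... | true  | false with refl , ρu≡u′ ← ,-injective eq =
      contradiction (trans (sym (closed v u vu)) (trans (cong (G v) ρu≡u′) vu′)) λ ()
    ... | false | true  with refl , u≡ρu′ ← ,-injective eq =
      contradiction (trans (sym (closed v u′ vu′)) (trans (cong (G v) (sym u≡ρu′)) vu)) λ ()

    face-injective : Injective _≡_ _≡_ face
    face-injective {x} {y} eq =
      trans (sym (reverse-involutive x)) (trans (cong (reverse G) (rotate-injective eq)) (reverse-involutive y))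

    iter-face-dart : ∀ {x} → isDart G x ≡ true → ∀ k → isDart G (iter face k x) ≡ true
    iter-face-dart x-dart zero    = x-dart
    iter-face-dart x-dart (suc k) = face-preserves-darts _ (iter-face-dart x-dart k)

    faceStep-dart : ∀ x → isDart G x ≡ true → faceStep R x ≡ face x
    faceStep-dart (u , v) uv = sym (face-dart uv)

    iter-faceStep : ∀ {x} → isDart G x ≡ true → ∀ k → iter (faceStep R) k x ≡ iter face k x
    iter-faceStep x-dart zero    = refl
    iter-faceStep x-dart (suc k) =
      trans (cong (faceStep R) (iter-faceStep x-dart k)) (faceStep-dart _ (iter-face-dart x-dart k))

    code≡rank : ∀ x → code R x ≡ rank x
    code≡rank (u , v) = trans (cong (_+ toℕ v) (*-comm (toℕ u) n)) (sym (toℕ-combine u v))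

    numFaces≡ : numFaces R ≡ ∑[ x ∈ pairs n ] 𝟙 (isDart G x ∧ isRepᵇ face x)
    numFaces≡ = trans (length-filterᵇ (isRep R) (pairs n)) (∑-cong (pairs n) (cong 𝟙 ∘ isRep≡))
      where
      isRep≡ : ∀ x → isRep R x ≡ isDart G x ∧ isRepᵇ face x
      isRep≡ (u , v) with G u v in uv
      ... | false = refl
      ... | true  = allᵇ-cong (λ k → cong₂ _≤ᵇ_ (code≡rank (u , v))
                                            (trans (cong (code R) (iter-faceStep uv k)) (code≡rank _)))
                              (upTo (n * n))

    nonDarts : ℕ
    nonDarts = ∑[ x ∈ pairs n ] 𝟙 (not (isDart G x))

    cycles-face : cycles face ≡ numFaces R + nonDarts
    cycles-face = trans (cycles-off-support face (isDart G) face-non-dart) (cong (_+ nonDarts) (sym numFaces≡))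

    rotate-iter : ∀ {v u} → Adj G v u → ∀ k → iter rotate k (v , u) ≡ (v , iter (ρ v) k u)
    rotate-iter vu zero = refl
    rotate-iter vu (suc k) rewrite rotate-iter vu k | iter-ρ-adj vu k = refl

    one-rotation-cycle-at : ∀ {v} → ∃[ u ] Adj G v u → ∑[ u ∈ allFin n ] 𝟙 (G v u ∧ isRepᵇ rotate (v , u)) ≡ 1
    one-rotation-cycle-at {v} (u₀ , vu₀) with Injection.rep-exists rotate-injective (v , u₀)
    ... | r , orbit k hit , rep = ∑-𝟙-unique (finListing n) (λ u → G v u ∧ isRepᵇ rotate (v , u)) w only-w w-counts
      where
      open Injection rotate-injective using (rep-unique)
      w : Fin n
      w = iter (ρ v) k u₀
      w↦r : (v , w) ≡ r
      w↦r = trans (sym (rotate-iter vu₀ k)) hit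
      w-counts : (G v w ∧ isRepᵇ rotate (v , w)) ≡ true
      w-counts = trans (cong (_∧ isRepᵇ rotate (v , w)) (iter-ρ-adj vu₀ k))
                       (subst (λ z → isRepᵇ rotate z ≡ true) (sym w↦r) rep)
      only-w : ∀ u → (G v u ∧ isRepᵇ rotate (v , u)) ≡ true → u ≡ w
      only-w u counts with G v u in vu
      ... | true with cyclic v u u₀ vu vu₀
      ...   | j , u↝u₀ = cong proj₂ (trans (rep-unique counts rep (orbit-trans u↝₀ (orbit k hit))) (sym w↦r))
        where
        u↝₀ : Orbit rotate (v , u) (v , u₀)
        u↝₀ = orbit j (trans (rotate-iter vu j) (cong (v ,_) u↝u₀))

    cycles-rotate : (∀ v → ∃[ u ] Adj G v u) → cycles rotate ≡ n + nonDarts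
    cycles-rotate neighbour = begin
      cycles rotate                                                                  ≡⟨ cycles-off-support rotate (isDart G) rotate-non-dart ⟩
      ∑[ x ∈ pairs n ] 𝟙 (isDart G x ∧ isRepᵇ rotate x) + nonDarts                  ≡⟨ cong (_+ nonDarts) (∑-cartesianProduct (allFin n) (allFin n) _) ⟩
      ∑[ v ∈ allFin n ] ∑[ u ∈ allFin n ] 𝟙 (G v u ∧ isRepᵇ rotate (v , u)) + nonDarts ≡⟨ cong (_+ nonDarts) (∑-cong (allFin n) (one-rotation-cycle-at ∘ neighbour)) ⟩
      ∑[ v ∈ allFin n ] 1 + nonDarts                                                 ≡⟨ cong (_+ nonDarts) (trans (∑-1 (allFin n)) (length-tabulate id)) ⟩
      n + nonDarts                                                                   ∎
      where open ≡-Reasoning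

    -- Faces and vertices are the cycles of rotate ∘ reverse G and of rotate, and each transposition in ts
    -- changes the number of cycles by one.
    face-parity : (∀ v → ∃[ u ] Adj G v u) → ∀ ts → All Distinct ts → (∀ x → transposeAll ts x ≡ reverse G x) →
                  even (numFaces R) ≡ even (length ts + n)
    face-parity neighbour ts distinct decomposes = even-+-cancelʳ {numFaces R} {length ts + n} nonDarts (begin
      even (numFaces R + nonDarts)             ≡⟨ cong even cycles-face ⟨
      even (cycles face)                       ≡⟨ cong even (cycles-cong λ x → cong rotate (sym (decomposes x))) ⟩
      even (cycles (rotate ∘ transposeAll ts)) ≡⟨ cycles-transposeAll rotate-injective ts distinct ⟩
      even (length ts + cycles rotate)         ≡⟨ cong (λ c → even (length ts + c)) (cycles-rotate neighbour) ⟩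
      even (length ts + (n + nonDarts))        ≡⟨ cong even (+-assoc (length ts) n nonDarts) ⟨
      even (length ts + n + nonDarts)          ∎)
      where open ≡-Reasoning

    3*faces≤darts : (∀ v u → Adj G v u → ∃[ w ] (Adj G v w × w ≢ u)) → 3 * numFaces R ≤ ∑[ x ∈ pairs n ] 𝟙 (isDart G x)
    3*faces≤darts second-neighbour = subst (λ F → 3 * F ≤ _) (sym numFaces≡)
      (Injection.3*cycles≤support face-injective (isDart G) face-preserves-darts no-loop no-digon)
      where
      no-loop : ∀ x → isDart G x ≡ true → face x ≢ x
      no-loop (u , v) uv fx≡x = contradiction (trans (sym (loopless u)) (trans (cong (G u) (sym v≡u)) uv)) λ ()
        where
        v≡u : v ≡ u
        v≡u = proj₁ (,-injective (trans (sym (face-dart uv)) fx≡x))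
      no-digon : ∀ x → isDart G x ≡ true → face (face x) ≢ x
      no-digon (u , v) uv ffx≡x with second-neighbour v u (trans (symmetric v u) uv)
      ... | w , vw , w≢u with cyclic v u w (trans (symmetric v u) uv) vw
      ...   | j , u↝w = w≢u (trans (sym u↝w) (iter-fixed (ρ v) ρu≡u j))
        where
        ρu≡u : ρ v u ≡ u
        ρu≡u = proj₁ (,-injective (trans (sym (trans (cong face (face-dart uv))
                                                      (face-dart (closed v u (trans (symmetric v u) uv))))) ffx≡x))

  genus-≥ : MinDegree≥2 G → All Distinct (edgeReversals G) → (∀ x → transposeAll (edgeReversals G) x ≡ reverse G x) →
            ∀ g → (∀ F → 3 * F ≤ 2 * numEdges G → even F ≡ even (numEdges G + n) → n + F + 2 * g ≤ 2 + numEdges G) →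
            ∀ R → n + numFaces R + 2 * g ≤ 2 + numEdges G
  genus-≥ min-degree distinct decomposes g arithmetic R = arithmetic (numFaces R)
    (subst (3 * numFaces R ≤_) (darts≡2*edges G symmetric loopless) (3*faces≤darts R second-neighbour))
    (trans (face-parity R neighbour (edgeReversals G) distinct decomposes) (cong (λ e → even (e + n)) (length-edgeReversals G)))
    where
    neighbour : ∀ v → ∃[ u ] Adj G v u
    neighbour v = let (u , _ , vu , _) = min-degree v in u , vu
    second-neighbour : ∀ v u → Adj G v u → ∃[ w ] (Adj G v w × w ≢ u)
    second-neighbour v u _ with min-degree v
    ... | a , b , va , vb , a≢b with a ≟ᶠ′ u
    ...   | yes refl = b , vb , a≢b ∘ sym
    ...   | no a≢u   = a , va , a≢u

-- Vertex connectivity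
Linked : ∀ {n} → Graph n → ℕ → Fin n → Fin n → Set
Linked {n} G k u v = ∀ (S : Subset n) → ∣ S ∣ < k → lookup S u ≡ false → lookup S v ≡ false → Reach G S u v

connectivity-≥ : ∀ {n} {G : Graph n} {k} → k < n → (∀ u v → Linked G k u v) → ∀ S → Separating G S → k ≤ ∣ S ∣
connectivity-≥ {k = k} k<n linked S separating with k ≤? ∣ S ∣ | separating
... | yes k≤∣S∣ | _                                  = k≤∣S∣
... | no k≰∣S∣  | inj₁ (u , v , u∉S , v∉S , ¬u↝v) = contradiction (linked u v S (≰⇒> k≰∣S∣) u∉S v∉S) ¬u↝v
... | no k≰∣S∣  | inj₂ n≤∣S∣+1                     =
  ⊥-elim (<-irrefl refl (<-≤-trans k<n (≤-trans n≤∣S∣+1 (subst (_≤ k) (+-comm 1 ∣ S ∣) (≰⇒> k≰∣S∣)))))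

neighbours : ∀ {n} → Graph n → Fin n → Subset n
neighbours G u = tabulate (G u)

reach-start : ∀ {n} {G : Graph n} {S x y} → Reach G S x y → lookup S x ≡ false
reach-start (here x∉S)     = x∉S
reach-start (step x∉S _ _) = x∉S

neighbours-separate : ∀ {n} {G : Graph n} u v → G u u ≡ false → G u v ≡ false → u ≢ v → Separating G (neighbours G u)
neighbours-separate {G = G} u v loop non-adjacent u≢v =
  inj₁ (u , v , trans (lookup∘tabulate (G u) u) loop , trans (lookup∘tabulate (G u) v) non-adjacent , stuck)
  where
  stuck : ¬ Reach G (neighbours G u) u v
  stuck (here _)           = u≢v refl
  stuck (step _ uw w↝v) with () ← trans (sym (trans (lookup∘tabulate (G u) _) uw)) (reach-start w↝v)

∣S∣<∣T∣⇒T⊈S : ∀ {n} (S T : Subset n) → ∣ S ∣ < ∣ T ∣ → ∃[ w ] (lookup T w ≡ true × lookup S w ≡ false)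
∣S∣<∣T∣⇒T⊈S (false ∷ S) (true  ∷ T) _             = fzero , refl , refl
∣S∣<∣T∣⇒T⊈S (true  ∷ S) (true  ∷ T) (s≤s ∣S∣<∣T∣) = let w , w∈T , w∉S = ∣S∣<∣T∣⇒T⊈S S T ∣S∣<∣T∣ in fsuc w , w∈T , w∉S
∣S∣<∣T∣⇒T⊈S (true  ∷ S) (false ∷ T) ∣S∣<∣T∣       = let w , w∈T , w∉S = ∣S∣<∣T∣⇒T⊈S S T (<-trans (n<1+n _) ∣S∣<∣T∣) in fsuc w , w∈T , w∉S
∣S∣<∣T∣⇒T⊈S (false ∷ S) (false ∷ T) ∣S∣<∣T∣       = let w , w∈T , w∉S = ∣S∣<∣T∣⇒T⊈S S T ∣S∣<∣T∣ in fsuc w , w∈T , w∉S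

common : ∀ {n} → Graph n → Fin n → Fin n → Subset n
common G u v = tabulate (λ w → G u w ∧ G w v)

module _ {n} {G : Graph n} {u v : Fin n} where

  via-common : ∀ {S w} → lookup S u ≡ false → lookup S v ≡ false → lookup (common G u v) w ≡ true → lookup S w ≡ false →
               Reach G S u v
  via-common {w = w} u∉S v∉S w∈C w∉S =
    step u∉S (∧-conicalˡ _ _ uw∧wv) (step w∉S (∧-conicalʳ _ _ uw∧wv) (here v∉S))
    where
    uw∧wv : (G u w ∧ G w v) ≡ true
    uw∧wv = trans (sym (lookup∘tabulate _ w)) w∈C

  linked-refl : ∀ {k} → u ≡ v → Linked G k u v
  linked-refl refl S _ u∉S _ = here u∉S

  linked-adjacent : ∀ {k} → Adj G u v → Linked G k u v
  linked-adjacent uv S _ u∉S v∉S = step u∉S uv (here v∉S)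

  linked-common : ∀ {k} → k ≤ ∣ common G u v ∣ → Linked G k u v
  linked-common k≤∣C∣ S ∣S∣<k u∉S v∉S =
    let w , w∈C , w∉S = ∣S∣<∣T∣⇒T⊈S S (common G u v) (<-≤-trans ∣S∣<k k≤∣C∣) in via-common u∉S v∉S w∈C w∉S

  common∪⁅⁆⁻ : ∀ {c w} → lookup (common G u v ∪ ⁅ c ⁆) w ≡ true → lookup (common G u v) w ≡ true ⊎ w ≡ c
  common∪⁅⁆⁻ {c} {w} w∈ with x∈p∪q⁻ (common G u v) ⁅ c ⁆ (lookup⇒[]= w _ w∈)
  ... | inj₁ w∈C = inj₁ ([]=⇒lookup w∈C)
  ... | inj₂ w∈c = inj₂ (x∈⁅y⁆⇒x≡y c w∈c)

  -- k - 1 common neighbours and a path u a b v: a set of fewer than k vertices misses a common neighbour, or both a and b.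
  linked-detour : ∀ {k a b} → Adj G u a → Adj G a b → Adj G b v →
                  k ≤ ∣ common G u v ∪ ⁅ a ⁆ ∣ → k ≤ ∣ common G u v ∪ ⁅ b ⁆ ∣ → Linked G k u v
  linked-detour {k} {a} {b} ua ab bv k≤∣C+a∣ k≤∣C+b∣ S ∣S∣<k u∉S v∉S
    with ∣S∣<∣T∣⇒T⊈S S (common G u v ∪ ⁅ a ⁆) (<-≤-trans ∣S∣<k k≤∣C+a∣) | ∣S∣<∣T∣⇒T⊈S S (common G u v ∪ ⁅ b ⁆) (<-≤-trans ∣S∣<k k≤∣C+b∣)
  ... | w , w∈C+a , w∉S | w′ , w′∈C+b , w′∉S with common∪⁅⁆⁻ {a} w∈C+a | common∪⁅⁆⁻ {b} w′∈C+b
  ...   | inj₁ w∈C | _          = via-common u∉S v∉S w∈C w∉S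
  ...   | inj₂ _   | inj₁ w′∈C  = via-common u∉S v∉S w′∈C w′∉S
  ...   | inj₂ refl | inj₂ refl = step u∉S ua (step w∉S ab (step w′∉S bv (here v∉S)))

LinkCertificate : ∀ {n} → Graph n → ℕ → Fin n → Fin n → Set
LinkCertificate G k u v =
  u ≡ v ⊎ Adj G u v ⊎ k ≤ ∣ common G u v ∣ ⊎
  ∃[ a ] ∃[ b ] (Adj G u a × Adj G a b × Adj G b v × k ≤ ∣ common G u v ∪ ⁅ a ⁆ ∣ × k ≤ ∣ common G u v ∪ ⁅ b ⁆ ∣)

linked : ∀ {n} {G : Graph n} {k u v} → LinkCertificate G k u v → Linked G k u v
linked (inj₁ u≡v)                                  = linked-refl u≡v
linked (inj₂ (inj₁ uv))                            = linked-adjacent uv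
linked (inj₂ (inj₂ (inj₁ k≤∣C∣)))                  = linked-common k≤∣C∣
linked (inj₂ (inj₂ (inj₂ (_ , _ , ua , ab , bv , k≤∣C+a∣ , k≤∣C+b∣)))) = linked-detour ua ab bv k≤∣C+a∣ k≤∣C+b∣

-- Certificates checked by evaluation
bounded-∀? : ∀ {P : ℕ → Set} → (∀ m → Dec (P m)) → ∀ D → Dec (∀ m → m ≤ D → P m)
bounded-∀? {P} P? D = map′ (λ all-P m m≤D → subst P (toℕ-fromℕ< (s≤s m≤D)) (all-P (fromℕ< (s≤s m≤D))))
                           (λ all-P i → all-P (toℕ i) (≤-pred (toℕ<n i)))
                           (all? λ (i : Fin (suc D)) → P? (toℕ i))

-- Row v lists ρ v u for u = 0, …, n - 1; the entries at non-neighbours of v are irrelevant.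
RotationTable : ℕ → Set
RotationTable n = Vec (Vec (Fin n) n) n

module Decisions {n} (G : Graph n) where

  symmetric? : Dec (∀ u v → G u v ≡ G v u)
  symmetric? = all? λ u → all? λ v → G u v Bool.≟ G v u

  loopless? : Dec (∀ v → G v v ≡ false)
  loopless? = all? λ v → G v v Bool.≟ false

  minDegree≥2? : Dec (MinDegree≥2 G)
  minDegree≥2? = all? λ v → any? λ u → any? λ w → (G v u Bool.≟ true) ×-dec (G v w Bool.≟ true) ×-dec ¬? (u ≟ᶠ′ w)

  distinctReversals? : Dec (All Distinct (edgeReversals G))
  distinctReversals? = All.all? (λ (a , b) → ¬? (Listing._≟_ (pairListing n) a b)) (edgeReversals G)

  reversal? : Dec (∀ x → transposeAll (edgeReversals G) x ≡ reverse G x)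
  reversal? = map′ (λ holds (u , v) → holds u v) (λ holds u v → holds (u , v))
                   (all? λ u → all? λ v → Listing._≟_ (pairListing n) (transposeAll (edgeReversals G) (u , v)) (reverse G (u , v)))

  module _ (T : RotationTable n) where

    successor : Fin n → Fin n → Fin n
    successor v u = lookup (lookup T v) u

    closed? : Dec (∀ v u → Adj G v u → Adj G v (successor v u))
    closed? = all? λ v → all? λ u → (G v u Bool.≟ true) →-dec (G v (successor v u) Bool.≟ true)

    cyclic? : Dec (∀ v u w → Adj G v u → Adj G v w → ∃ λ (k : Fin n) → iter (successor v) (toℕ k) u ≡ w)
    cyclic? = all? λ v → all? λ u → all? λ w → (G v u Bool.≟ true) →-dec (G v w Bool.≟ true) →-dec
                any? λ k → iter (successor v) (toℕ k) u ≟ᶠ′ w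

    tableRotation : True closed? → True cyclic? → Rotation G
    tableRotation closed-ok cyclic-ok = record
      { ρ      = successor
      ; closed = toWitness closed-ok
      ; cyclic = λ v u w vu vw → let k , hit = toWitness cyclic-ok v u w vu vw in toℕ k , hit
      }

  EulerBound : ℕ → ℕ → Set
  EulerBound g F = 3 * F ≤ 2 * numEdges G → even F ≡ even (numEdges G + n) → n + F + 2 * g ≤ 2 + numEdges G

  eulerBound? : ∀ g → Dec (∀ F → F ≤ 2 * numEdges G → EulerBound g F)
  eulerBound? g = bounded-∀? (λ F → (3 * F ≤? 2 * numEdges G) →-dec (even F Bool.≟ even (numEdges G + n)) →-dec
                                    (n + F + 2 * g ≤? 2 + numEdges G))
                             (2 * numEdges G)

  linkCertificates? : ∀ k → Dec (∀ u v → LinkCertificate G k u v)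
  linkCertificates? k = all? λ u → all? λ v →
    (u ≟ᶠ′ v) ⊎-dec (G u v Bool.≟ true) ⊎-dec (k ≤? ∣ common G u v ∣) ⊎-dec
    any? λ a → any? λ b → (G u a Bool.≟ true) ×-dec (G a b Bool.≟ true) ×-dec (G b v Bool.≟ true) ×-dec
                          (k ≤? ∣ common G u v ∪ ⁅ a ⁆ ∣) ×-dec (k ≤? ∣ common G u v ∪ ⁅ b ⁆ ∣)

module _ {n} {G : Graph n} where
  open Decisions G

  orientableGenus-by-computation :
    ∀ g (T : RotationTable n) (closed-ok : True (closed? T)) (cyclic-ok : True (cyclic? T)) →
    n + numFaces (tableRotation T closed-ok cyclic-ok) + 2 * g ≡ 2 + numEdges G →
    True symmetric? → True loopless? → True minDegree≥2? → True distinctReversals? → True reversal? →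
    True (eulerBound? g) → OrientableGenus G g
  orientableGenus-by-computation g T closed-ok cyclic-ok faces sym loop deg distinct reversal euler =
    (tableRotation T closed-ok cyclic-ok , faces) ,
    Embedding.genus-≥ (toWitness sym) (toWitness loop) (toWitness deg) (toWitness distinct) (toWitness reversal) g
      λ F 3F≤2E → toWitness euler F (≤-trans (m≤n*m F 3) 3F≤2E) 3F≤2E

  vertexConnectivity-by-computation : ∀ k (S : Subset n) → ∣ S ∣ ≡ k → Separating G S →
                                      True (k <? n) → True (linkCertificates? k) → VertexConnectivity G k
  vertexConnectivity-by-computation k S ∣S∣≡k separating k<n certificates =
    (S , ∣S∣≡k , separating) , connectivity-≥ (toWitness k<n) λ u v → linked (toWitness certificates u v)

-- The four graphs
K₁₀-rotation : RotationTable 10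
K₁₀-rotation =
  (# 0 ∷ # 9 ∷ # 6 ∷ # 1 ∷ # 7 ∷ # 3 ∷ # 5 ∷ # 2 ∷ # 4 ∷ # 8 ∷ []) ∷
  (# 2 ∷ # 1 ∷ # 7 ∷ # 6 ∷ # 9 ∷ # 8 ∷ # 4 ∷ # 5 ∷ # 3 ∷ # 0 ∷ []) ∷
  (# 7 ∷ # 5 ∷ # 2 ∷ # 8 ∷ # 3 ∷ # 9 ∷ # 0 ∷ # 1 ∷ # 6 ∷ # 4 ∷ []) ∷
  (# 5 ∷ # 8 ∷ # 4 ∷ # 3 ∷ # 0 ∷ # 7 ∷ # 1 ∷ # 9 ∷ # 2 ∷ # 6 ∷ []) ∷
  (# 8 ∷ # 6 ∷ # 9 ∷ # 2 ∷ # 4 ∷ # 3 ∷ # 7 ∷ # 0 ∷ # 5 ∷ # 1 ∷ []) ∷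
  (# 6 ∷ # 7 ∷ # 4 ∷ # 0 ∷ # 8 ∷ # 5 ∷ # 9 ∷ # 3 ∷ # 1 ∷ # 2 ∷ []) ∷
  (# 2 ∷ # 3 ∷ # 8 ∷ # 9 ∷ # 1 ∷ # 0 ∷ # 6 ∷ # 4 ∷ # 7 ∷ # 5 ∷ []) ∷
  (# 4 ∷ # 2 ∷ # 0 ∷ # 5 ∷ # 6 ∷ # 1 ∷ # 8 ∷ # 7 ∷ # 9 ∷ # 3 ∷ []) ∷
  (# 9 ∷ # 5 ∷ # 3 ∷ # 1 ∷ # 0 ∷ # 4 ∷ # 2 ∷ # 6 ∷ # 8 ∷ # 7 ∷ []) ∷
  (# 1 ∷ # 4 ∷ # 5 ∷ # 7 ∷ # 2 ∷ # 6 ∷ # 3 ∷ # 8 ∷ # 0 ∷ # 9 ∷ []) ∷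
  []

K₁₂-C₁₂-rotation : RotationTable 12
K₁₂-C₁₂-rotation =
  (# 0 ∷ # 1 ∷ # 4 ∷ # 10 ∷ # 8 ∷ # 7 ∷ # 9 ∷ # 2 ∷ # 6 ∷ # 3 ∷ # 5 ∷ # 11 ∷ []) ∷
  (# 0 ∷ # 1 ∷ # 2 ∷ # 6 ∷ # 9 ∷ # 10 ∷ # 4 ∷ # 11 ∷ # 3 ∷ # 5 ∷ # 7 ∷ # 8 ∷ []) ∷
  (# 7 ∷ # 1 ∷ # 2 ∷ # 3 ∷ # 0 ∷ # 9 ∷ # 8 ∷ # 10 ∷ # 5 ∷ # 11 ∷ # 6 ∷ # 4 ∷ []) ∷
  (# 9 ∷ # 8 ∷ # 2 ∷ # 3 ∷ # 4 ∷ # 11 ∷ # 1 ∷ # 5 ∷ # 10 ∷ # 7 ∷ # 0 ∷ # 6 ∷ []) ∷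
  (# 2 ∷ # 6 ∷ # 11 ∷ # 3 ∷ # 4 ∷ # 5 ∷ # 10 ∷ # 9 ∷ # 0 ∷ # 1 ∷ # 8 ∷ # 7 ∷ []) ∷
  (# 10 ∷ # 9 ∷ # 8 ∷ # 7 ∷ # 4 ∷ # 5 ∷ # 6 ∷ # 0 ∷ # 11 ∷ # 2 ∷ # 1 ∷ # 3 ∷ []) ∷
  (# 8 ∷ # 3 ∷ # 10 ∷ # 11 ∷ # 1 ∷ # 5 ∷ # 6 ∷ # 7 ∷ # 2 ∷ # 0 ∷ # 4 ∷ # 9 ∷ []) ∷
  (# 5 ∷ # 10 ∷ # 0 ∷ # 9 ∷ # 11 ∷ # 3 ∷ # 6 ∷ # 7 ∷ # 8 ∷ # 4 ∷ # 2 ∷ # 1 ∷ []) ∷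
  (# 4 ∷ # 11 ∷ # 6 ∷ # 1 ∷ # 10 ∷ # 2 ∷ # 0 ∷ # 7 ∷ # 8 ∷ # 9 ∷ # 3 ∷ # 5 ∷ []) ∷
  (# 6 ∷ # 4 ∷ # 5 ∷ # 0 ∷ # 7 ∷ # 1 ∷ # 11 ∷ # 3 ∷ # 8 ∷ # 9 ∷ # 10 ∷ # 2 ∷ []) ∷
  (# 3 ∷ # 5 ∷ # 7 ∷ # 8 ∷ # 6 ∷ # 0 ∷ # 2 ∷ # 1 ∷ # 4 ∷ # 9 ∷ # 10 ∷ # 11 ∷ []) ∷
  (# 0 ∷ # 7 ∷ # 9 ∷ # 5 ∷ # 2 ∷ # 8 ∷ # 3 ∷ # 4 ∷ # 1 ∷ # 6 ∷ # 10 ∷ # 11 ∷ []) ∷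
  []

K₁₄-rotation : RotationTable 14
K₁₄-rotation =
  (# 0 ∷ # 2 ∷ # 12 ∷ # 13 ∷ # 6 ∷ # 3 ∷ # 5 ∷ # 11 ∷ # 4 ∷ # 1 ∷ # 9 ∷ # 10 ∷ # 8 ∷ # 7 ∷ []) ∷
  (# 9 ∷ # 1 ∷ # 0 ∷ # 8 ∷ # 2 ∷ # 3 ∷ # 5 ∷ # 12 ∷ # 11 ∷ # 7 ∷ # 4 ∷ # 13 ∷ # 6 ∷ # 10 ∷ []) ∷
  (# 1 ∷ # 4 ∷ # 2 ∷ # 7 ∷ # 8 ∷ # 10 ∷ # 12 ∷ # 5 ∷ # 9 ∷ # 13 ∷ # 6 ∷ # 3 ∷ # 0 ∷ # 11 ∷ []) ∷
  (# 2 ∷ # 5 ∷ # 11 ∷ # 3 ∷ # 9 ∷ # 4 ∷ # 8 ∷ # 10 ∷ # 1 ∷ # 12 ∷ # 13 ∷ # 6 ∷ # 7 ∷ # 0 ∷ []) ∷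
  (# 8 ∷ # 10 ∷ # 1 ∷ # 5 ∷ # 4 ∷ # 11 ∷ # 0 ∷ # 6 ∷ # 2 ∷ # 3 ∷ # 12 ∷ # 7 ∷ # 13 ∷ # 9 ∷ []) ∷
  (# 6 ∷ # 0 ∷ # 7 ∷ # 1 ∷ # 3 ∷ # 5 ∷ # 9 ∷ # 8 ∷ # 13 ∷ # 10 ∷ # 2 ∷ # 4 ∷ # 11 ∷ # 12 ∷ []) ∷
  (# 4 ∷ # 12 ∷ # 10 ∷ # 11 ∷ # 1 ∷ # 0 ∷ # 6 ∷ # 13 ∷ # 3 ∷ # 5 ∷ # 7 ∷ # 9 ∷ # 2 ∷ # 8 ∷ []) ∷
  (# 13 ∷ # 9 ∷ # 4 ∷ # 12 ∷ # 11 ∷ # 2 ∷ # 10 ∷ # 7 ∷ # 5 ∷ # 8 ∷ # 3 ∷ # 0 ∷ # 1 ∷ # 6 ∷ []) ∷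
  (# 12 ∷ # 3 ∷ # 4 ∷ # 6 ∷ # 0 ∷ # 7 ∷ # 13 ∷ # 9 ∷ # 8 ∷ # 2 ∷ # 11 ∷ # 1 ∷ # 10 ∷ # 5 ∷ []) ∷
  (# 10 ∷ # 0 ∷ # 8 ∷ # 4 ∷ # 13 ∷ # 6 ∷ # 11 ∷ # 1 ∷ # 7 ∷ # 9 ∷ # 5 ∷ # 12 ∷ # 3 ∷ # 2 ∷ []) ∷
  (# 11 ∷ # 13 ∷ # 5 ∷ # 7 ∷ # 1 ∷ # 9 ∷ # 2 ∷ # 6 ∷ # 12 ∷ # 0 ∷ # 10 ∷ # 8 ∷ # 4 ∷ # 3 ∷ []) ∷
  (# 7 ∷ # 8 ∷ # 13 ∷ # 2 ∷ # 5 ∷ # 12 ∷ # 3 ∷ # 4 ∷ # 10 ∷ # 6 ∷ # 0 ∷ # 11 ∷ # 9 ∷ # 1 ∷ []) ∷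
  (# 2 ∷ # 7 ∷ # 6 ∷ # 9 ∷ # 10 ∷ # 13 ∷ # 1 ∷ # 3 ∷ # 0 ∷ # 11 ∷ # 8 ∷ # 5 ∷ # 12 ∷ # 4 ∷ []) ∷
  (# 3 ∷ # 11 ∷ # 9 ∷ # 10 ∷ # 12 ∷ # 8 ∷ # 7 ∷ # 0 ∷ # 6 ∷ # 4 ∷ # 1 ∷ # 2 ∷ # 5 ∷ # 13 ∷ []) ∷
  []

K₁₅-6K₂-rotation : RotationTable 15
K₁₅-6K₂-rotation =
  (# 0 ∷ # 1 ∷ # 5 ∷ # 8 ∷ # 6 ∷ # 14 ∷ # 12 ∷ # 9 ∷ # 10 ∷ # 3 ∷ # 13 ∷ # 7 ∷ # 2 ∷ # 4 ∷ # 11 ∷ []) ∷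
  (# 0 ∷ # 1 ∷ # 4 ∷ # 12 ∷ # 7 ∷ # 10 ∷ # 9 ∷ # 3 ∷ # 2 ∷ # 11 ∷ # 14 ∷ # 5 ∷ # 6 ∷ # 8 ∷ # 13 ∷ []) ∷
  (# 12 ∷ # 8 ∷ # 2 ∷ # 3 ∷ # 1 ∷ # 0 ∷ # 13 ∷ # 14 ∷ # 6 ∷ # 5 ∷ # 7 ∷ # 9 ∷ # 10 ∷ # 11 ∷ # 4 ∷ []) ∷
  (# 9 ∷ # 7 ∷ # 2 ∷ # 3 ∷ # 8 ∷ # 6 ∷ # 4 ∷ # 11 ∷ # 0 ∷ # 14 ∷ # 5 ∷ # 13 ∷ # 1 ∷ # 10 ∷ # 12 ∷ []) ∷
  (# 13 ∷ # 2 ∷ # 14 ∷ # 6 ∷ # 4 ∷ # 5 ∷ # 0 ∷ # 1 ∷ # 3 ∷ # 10 ∷ # 12 ∷ # 8 ∷ # 11 ∷ # 7 ∷ # 9 ∷ []) ∷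
  (# 2 ∷ # 11 ∷ # 9 ∷ # 10 ∷ # 4 ∷ # 5 ∷ # 3 ∷ # 8 ∷ # 14 ∷ # 13 ∷ # 1 ∷ # 12 ∷ # 7 ∷ # 6 ∷ # 0 ∷ []) ∷
  (# 4 ∷ # 12 ∷ # 8 ∷ # 5 ∷ # 3 ∷ # 13 ∷ # 6 ∷ # 7 ∷ # 11 ∷ # 1 ∷ # 9 ∷ # 14 ∷ # 0 ∷ # 2 ∷ # 10 ∷ []) ∷
  (# 11 ∷ # 4 ∷ # 10 ∷ # 1 ∷ # 13 ∷ # 12 ∷ # 6 ∷ # 7 ∷ # 5 ∷ # 0 ∷ # 8 ∷ # 3 ∷ # 9 ∷ # 14 ∷ # 2 ∷ []) ∷
  (# 3 ∷ # 13 ∷ # 1 ∷ # 4 ∷ # 11 ∷ # 7 ∷ # 2 ∷ # 10 ∷ # 8 ∷ # 9 ∷ # 0 ∷ # 6 ∷ # 14 ∷ # 12 ∷ # 5 ∷ []) ∷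
  (# 7 ∷ # 6 ∷ # 11 ∷ # 0 ∷ # 14 ∷ # 2 ∷ # 10 ∷ # 12 ∷ # 8 ∷ # 9 ∷ # 4 ∷ # 1 ∷ # 13 ∷ # 5 ∷ # 3 ∷ []) ∷
  (# 8 ∷ # 5 ∷ # 12 ∷ # 13 ∷ # 9 ∷ # 3 ∷ # 14 ∷ # 2 ∷ # 7 ∷ # 6 ∷ # 10 ∷ # 11 ∷ # 4 ∷ # 0 ∷ # 1 ∷ []) ∷
  (# 14 ∷ # 9 ∷ # 13 ∷ # 7 ∷ # 12 ∷ # 1 ∷ # 8 ∷ # 0 ∷ # 4 ∷ # 2 ∷ # 10 ∷ # 11 ∷ # 5 ∷ # 3 ∷ # 6 ∷ []) ∷
  (# 6 ∷ # 3 ∷ # 0 ∷ # 14 ∷ # 10 ∷ # 11 ∷ # 1 ∷ # 5 ∷ # 13 ∷ # 7 ∷ # 2 ∷ # 4 ∷ # 12 ∷ # 9 ∷ # 8 ∷ []) ∷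
  (# 10 ∷ # 14 ∷ # 6 ∷ # 11 ∷ # 0 ∷ # 9 ∷ # 5 ∷ # 4 ∷ # 1 ∷ # 12 ∷ # 3 ∷ # 2 ∷ # 8 ∷ # 13 ∷ # 7 ∷ []) ∷
  (# 5 ∷ # 10 ∷ # 7 ∷ # 9 ∷ # 2 ∷ # 8 ∷ # 11 ∷ # 13 ∷ # 12 ∷ # 4 ∷ # 6 ∷ # 0 ∷ # 3 ∷ # 1 ∷ # 14 ∷ []) ∷
  []

K₁₀-genus : OrientableGenus (K 10) 4
K₁₀-genus = orientableGenus-by-computation 4 K₁₀-rotation _ _ refl _ _ _ _ _ _

K₁₂-C₁₂-genus : OrientableGenus (KminusCycle 12) 4
K₁₂-C₁₂-genus = orientableGenus-by-computation 4 K₁₂-C₁₂-rotation _ _ refl _ _ _ _ _ _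

K₁₄-genus : OrientableGenus (K 14) 10
K₁₄-genus = orientableGenus-by-computation 10 K₁₄-rotation _ _ refl _ _ _ _ _ _

K₁₅-6K₂-genus : OrientableGenus (KminusMatching 15 6) 10
K₁₅-6K₂-genus = orientableGenus-by-computation 10 K₁₅-6K₂-rotation _ _ refl _ _ _ _ _ _

K₁₀-connectivity : VertexConnectivity (K 10) 9
K₁₀-connectivity = vertexConnectivity-by-computation 9 (∁ ⁅ # 0 ⁆) refl (inj₂ ≤-refl) _ _

K₁₂-C₁₂-connectivity : VertexConnectivity (KminusCycle 12) 9
K₁₂-C₁₂-connectivity = vertexConnectivity-by-computation 9 (neighbours (KminusCycle 12) (# 0)) refl
                         (neighbours-separate (# 0) (# 1) refl refl λ ()) _ _

K₁₄-connectivity : VertexConnectivity (K 14) 13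
K₁₄-connectivity = vertexConnectivity-by-computation 13 (∁ ⁅ # 0 ⁆) refl (inj₂ ≤-refl) _ _

K₁₅-6K₂-connectivity : VertexConnectivity (KminusMatching 15 6) 13
K₁₅-6K₂-connectivity = vertexConnectivity-by-computation 13 (neighbours (KminusMatching 15 6) (# 0)) refl
                         (neighbours-separate (# 0) (# 1) refl refl λ ()) _ _

proposition1 :
    (VertexConnectivity (K 10) 9 × OrientableGenus (K 10) 4)
    × (VertexConnectivity (KminusCycle 12) 9 × OrientableGenus (KminusCycle 12) 4)
    × (VertexConnectivity (K 14) 13 × OrientableGenus (K 14) 10)
    × (VertexConnectivity (KminusMatching 15 6) 13 × OrientableGenus (KminusMatching 15 6) 10)
    × ¬ IsComplete (KminusCycle 12)
    × ¬ IsComplete (KminusMatching 15 6)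
proposition1 =
  (K₁₀-connectivity , K₁₀-genus) ,
  (K₁₂-C₁₂-connectivity , K₁₂-C₁₂-genus) ,
  (K₁₄-connectivity , K₁₄-genus) ,
  (K₁₅-6K₂-connectivity , K₁₅-6K₂-genus) ,
  non-edge⇒¬complete (# 0) (# 1) (λ ()) refl ,
  non-edge⇒¬complete (# 0) (# 1) (λ ()) refl
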